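{- Let $q$ be an indeterminate and let $m,n,r\geq 0$ and $k\ge0$ be integers. Then $$L^{(r)}_q(m+n,k)=\sum_{i=0}^n \sum_{j=0}^k q^{i(j+m+2r)}[j+m+2r]_q ^{\overline{n-i}}\binom{n}{i}_qL_q^{(r)}(m,j)\,L_q(i,k-j)$$ and $$L^{(r)}_q(m+n)=\sum_{i=0}^n \sum_{j=0}^m q^{i(j+m+2r)}[j+m+2r]_q ^{\overline{n-i}}\binom{n}{i}_qL_q^{(r)}(m,j)\,L_q(i).$$
   Context: For an integer $a\ge1$, $a_q=[a]_q=1+q+\cdots+q^{a-1}$, $0_q=0$, $a_q!=\prod_{i=1}^a i_q$, $0_q!=1$. The $q$-binomial coefficient is $\binom{n}{k}_q=\frac{n_q!}{k_q!(n-k)_q!}$ for $0\le k\le n$, $\binom{n}{0}_q=1$ for all integers $n$, and $0$ otherwise. The $q$-rising factorial is $[a]_q^{\overline{b}}=\prod_{i=a}^{a+b-1}i_q$ for $b\ge1$ and $[a]_q^{\overline{0}}=1$. A Lah distribution of a finite set of positive integers is a partition of it into nonempty blocks in which each block is linearly ordered (written as a word). For a Lah distribution $\delta$ with $k$ blocks, write the blocks as words $W_1,W_2,\dots,W_k$ arranged in decreasing order of their least elements and let $\mathrm{inv}_\rho(\delta)$ be the number of inversions (pairs of positions $s<t$ with the letter at $s$ larger than the letter at $t$) of the single word $W_1\,0\,W_2\,0\cdots 0\,W_k$ (commas replaced by the letter $0$). Let $L_q(n,k)=\sum_\delta q^{\mathrm{inv}_\rho(\delta)}$ over all Lah distributions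 $\delta$ of $[n]$ with $k$ blocks (so $L_q(0,0)=1$ and $L_q(n,k)=0$ if $k>n$ or $k<0$), and $L_q(n)=\sum_{k=0}^nL_q(n,k)$. For $r\ge0$, let $\mathcal{L}^{(r)}_{n,k}$ be the set of Lah distributions of $[n+r]$ into $k+r$ blocks in which $1,\dots,r$ lie in distinct blocks, $L_q^{(r)}(n,k)=\sum_{\delta\in\mathcal{L}^{(r)}_{n,k}}q^{\mathrm{inv}_\rho(\delta)}$ (zero if $k>n$ or $k<0$), and $L_q^{(r)}(n)=\sum_{k=0}^nL_q^{(r)}(n,k)$. -}

module Defs where

open import Data.Nat using (ℕ; zero; suc; _+_; _*_; _∸_; _^_; _⊓_; _≡ᵇ_; _<ᵇ_; _≤ᵇ_; NonZero)
open import Data.Nat.Properties using (m*n≢0)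
open import Data.Nat.DivMod using (_/_)
open import Data.Bool using (Bool; true; false; _∧_; not; if_then_else_)
open import Data.Nat.ListAction using (sum; product)
open import Data.List using (List; []; _∷_; map; upTo; concatMap; concat; length; intercalate; all; filter)

-- q-analogues, evaluated at a natural number q

qint : ℕ → ℕ → ℕ
qint q a = sum (map (q ^_) (upTo a))

qfact : ℕ → ℕ → ℕ
qfact q a = product (map (λ i → qint q (suc i)) (upTo a))

qint-suc-nz : ∀ q a → NonZero (qint q (suc a))
qint-suc-nz q a = _

qfact-nz : ∀ q a → NonZero (qfact q a)
qfact-nz q zero = _
qfact-nz q (suc a) = m*n≢0 (qint q 1) _ {{_}} {{rest}}
  where
  rest : NonZero (product (map (λ i → qint q (suc i)) (Data.List.applyUpTo suc a)))
  rest = helper suc a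
    where
    helper : (f : ℕ → ℕ) → (b : ℕ) → NonZero (product (map (λ i → qint q (suc i)) (Data.List.applyUpTo f b)))
    helper f zero = _
    helper f (suc b) = m*n≢0 (qint q (suc (f 0))) _ {{qint-suc-nz q (f 0)}} {{helper (λ x → f (suc x)) b}}

qbinom : ℕ → ℕ → ℕ → ℕ
qbinom q n k = if k ≤ᵇ n
  then (qfact q n / (qfact q k * qfact q (n ∸ k))) {{m*n≢0 (qfact q k) (qfact q (n ∸ k)) {{qfact-nz q k}} {{qfact-nz q (n ∸ k)}}}}
  else 0

qrising : ℕ → ℕ → ℕ → ℕ
qrising q a b = product (map (λ i → qint q (a + i)) (upTo b))

-- Lah distributions, represented as lists of blocks (words)

wordsOfLength : ℕ → ℕ → List (List ℕ)
wordsOfLength N zero = [] ∷ []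
wordsOfLength N (suc l) = concatMap (λ a → map (a ∷_) (wordsOfLength N l)) (map suc (upTo N))

wordsUpTo : ℕ → List (List ℕ)
wordsUpTo N = concatMap (wordsOfLength N) (upTo (suc N))

blockLists : ℕ → ℕ → List (List (List ℕ))
blockLists N zero = [] ∷ []
blockLists N (suc k) = concatMap (λ w → map (w ∷_) (blockLists N k)) (wordsUpTo N)

count : ℕ → List ℕ → ℕ
count x [] = 0
count x (y ∷ ys) = if x ≡ᵇ y then suc (count x ys) else count x ys

nonempty : List ℕ → Bool
nonempty [] = false
nonempty (_ ∷ _) = true

minWord : List ℕ → ℕ
minWord [] = 0
minWord (x ∷ xs) = Data.List.foldr _⊓_ x xs

decreasingMins : List (List ℕ) → Bool
decreasingMins [] = true
decreasingMins (b ∷ []) = true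
decreasingMins (b ∷ c ∷ bs) = (minWord c <ᵇ minWord b) ∧ decreasingMins (c ∷ bs)

-- δ is a Lah distribution of [N] (blocks nonempty, every element of [N]
-- occurring exactly once), written in canonical order
isLah : ℕ → List (List ℕ) → Bool
isLah N δ = all nonempty δ
  ∧ all (λ i → count i (concat δ) ≡ᵇ 1) (map suc (upTo N))
  ∧ (length (concat δ) ≡ᵇ N)
  ∧ decreasingMins δ

separated : ℕ → List (List ℕ) → Bool
separated r δ = all (λ b → length (filter (λ x → x Data.Nat.≤? r) b) ≤ᵇ 1) δ

inv : List ℕ → ℕ
inv [] = 0
inv (x ∷ xs) = length (filter (λ y → y Data.Nat.<? x) xs) + inv xs

invρ : List (List ℕ) → ℕ
invρ δ = inv (intercalate (0 ∷ []) δ)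

Lr : ℕ → ℕ → ℕ → ℕ → ℕ
Lr q r n k = sum (map (λ δ → if isLah (n + r) δ ∧ separated r δ then q ^ invρ δ else 0)
                      (blockLists (n + r) (k + r)))

Lrtot : ℕ → ℕ → ℕ → ℕ
Lrtot q r n = sum (map (Lr q r n) (upTo (suc n)))

L : ℕ → ℕ → ℕ → ℕ
L q n k = Lr q 0 n k

Ltot : ℕ → ℕ → ℕ
Ltot q n = sum (map (L q n) (upTo (suc n)))

Σ≤ : ℕ → (ℕ → ℕ) → ℕ
Σ≤ n f = sum (map f (upTo (suc n)))

-- Write L(n,k) for L_q^(r)(n,k).  Deleting the largest letter N+1 (N = n+r) from a Lah
-- distribution of [N+1] into K+1 blocks (K = k+r) leaves a distribution of [N]: into K blocks
-- if N+1 formed a singleton block (necessarily the first one, as its minimum is largest,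
-- accounting for N+K inversions), and into K+1 blocks otherwise, N+1 having sat at one of the
-- N+K+1 positions p of W₁ 0 W₂ 0 ⋯ 0 W_k, where it accounts for N+K−p inversions.  Hence
--   L(n+1,k+1) = q^(2r+n+k) L(n,k) + [2r+n+k+1]_q L(n,k+1),   L(n+1,0) = [2r+n]_q L(n,0),
-- the latter because fewer than r blocks cannot separate 1,…,r.  An array obeying these rules
-- with 2r replaced by s (a Lah array of shift s) is determined by its row n = 0.  By the
-- q-Pascal rule, Σ_i q^(ic) [c]_q^(n−i) (n choose i)_q L_q(i,l) is a Lah array of shift c for
-- every c, and a convolution Σ_j B_j F_j(n,k−j) of Lah arrays F_j of shifts j+s is a Lah array
-- of shift s.  The right-hand side of the first identity is such a convolution, with
-- B_j = L(m,j) and s = m+2r, and it agrees with n ↦ L(m+n,k) at n = 0.  Summing over k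
-- gives the second identity.

module Submission where

open import Defs
open import Data.Nat using (ℕ; _+_; _*_; _∸_; _^_)
open import Data.Product using (_×_; _,_)
open import Relation.Binary.PropositionalEquality using (_≡_)

module FiniteSums where

  open import Data.Nat using (ℕ; zero; suc; _+_; _*_; _∸_; _≤_; _<_; z≤n; s≤s)
  open import Data.Nat.Properties
  open import Data.Nat.ListAction using (sum)
  open import Data.Nat.Solver using (module +-*-Solver)
  open import Data.List using (applyUpTo)
  open import Data.List.Properties using (map-upTo)
  open import Relation.Binary.PropositionalEquality
  open +-*-Solver using (solve; _:=_; _:+_; _:*_)
  open ≡-Reasoning

  -- Summing applyUpTo makes Σ< (suc n) f reduce to f 0 + Σ< n (f ∘ suc).
  Σ< : ℕ → (ℕ → ℕ) → ℕ
  Σ< n f = sum (applyUpTo f n)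

  Σ≤≡Σ< : ∀ n f → Σ≤ n f ≡ Σ< (suc n) f
  Σ≤≡Σ< n f = cong sum (map-upTo f (suc n))

  Σ<-cong : ∀ n {f g : ℕ → ℕ} → (∀ i → i < n → f i ≡ g i) → Σ< n f ≡ Σ< n g
  Σ<-cong zero h = refl
  Σ<-cong (suc n) h = cong₂ _+_ (h 0 (s≤s z≤n)) (Σ<-cong n (λ i i<n → h (suc i) (s≤s i<n)))

  Σ<-init-last : ∀ n f → Σ< (suc n) f ≡ Σ< n f + f n
  Σ<-init-last zero f = +-comm (f 0) 0
  Σ<-init-last (suc n) f =
    trans (cong (f 0 +_) (Σ<-init-last n (λ i → f (suc i)))) (sym (+-assoc (f 0) _ _))

  Σ<-distrib-+ : ∀ n f g → Σ< n (λ i → f i + g i) ≡ Σ< n f + Σ< n g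
  Σ<-distrib-+ zero f g = refl
  Σ<-distrib-+ (suc n) f g =
    trans (cong (f 0 + g 0 +_) (Σ<-distrib-+ n (λ i → f (suc i)) (λ i → g (suc i))))
      (solve 4 (λ a b c d → (a :+ b) :+ (c :+ d) := (a :+ c) :+ (b :+ d)) refl (f 0) (g 0) _ _)

  *-distribˡ-Σ< : ∀ n c f → c * Σ< n f ≡ Σ< n (λ i → c * f i)
  *-distribˡ-Σ< zero c f = *-zeroʳ c
  *-distribˡ-Σ< (suc n) c f =
    trans (*-distribˡ-+ c (f 0) _) (cong (c * f 0 +_) (*-distribˡ-Σ< n c (λ i → f (suc i))))

  Σ<-split : ∀ a b f → Σ< (a + b) f ≡ Σ< a f + Σ< b (λ i → f (a + i))
  Σ<-split zero b f = refl
  Σ<-split (suc a) b f =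
    trans (cong (f 0 +_) (Σ<-split a b (λ i → f (suc i)))) (sym (+-assoc (f 0) _ _))

  Σ<-zero : ∀ n f → (∀ i → i < n → f i ≡ 0) → Σ< n f ≡ 0
  Σ<-zero zero f h = refl
  Σ<-zero (suc n) f h = cong₂ _+_ (h 0 (s≤s z≤n)) (Σ<-zero n (λ i → f (suc i)) (λ i i<n → h (suc i) (s≤s i<n)))

  Σ<-comm : ∀ a b (f : ℕ → ℕ → ℕ) →
    Σ< a (λ i → Σ< b (λ j → f i j)) ≡ Σ< b (λ j → Σ< a (λ i → f i j))
  Σ<-comm zero b f = sym (Σ<-zero b _ (λ _ _ → refl))
  Σ<-comm (suc a) b f = trans (cong (Σ< b (f 0) +_) (Σ<-comm a b (λ i → f (suc i))))
    (sym (Σ<-distrib-+ b (f 0) (λ j → Σ< a (λ i → f (suc i) j))))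

  Σ<-truncate : ∀ {a n} f → a ≤ n → (∀ i → a ≤ i → f i ≡ 0) → Σ< n f ≡ Σ< a f
  Σ<-truncate {a} {n} f a≤n h = begin
    Σ< n f                                            ≡⟨ cong (λ z → Σ< z f) (sym (m+[n∸m]≡n a≤n)) ⟩
    Σ< (a + (n ∸ a)) f                                ≡⟨ Σ<-split a (n ∸ a) f ⟩
    Σ< a f + Σ< (n ∸ a) (λ i → f (a + i))            ≡⟨ cong (Σ< a f +_) (Σ<-zero (n ∸ a) _ (λ i _ → h (a + i) (m≤m+n a i))) ⟩
    Σ< a f + 0                                        ≡⟨ +-identityʳ _ ⟩
    Σ< a f                                            ∎

  Σ<-reverse : ∀ n f → Σ< n (λ i → f (n ∸ suc i)) ≡ Σ< n f
  Σ<-reverse zero f = refl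
  Σ<-reverse (suc n) f =
    trans (trans (cong (f n +_) (Σ<-reverse n f)) (+-comm (f n) _)) (sym (Σ<-init-last n f))

  Σ<-triangle : ∀ K (h : ℕ → ℕ → ℕ) →
    Σ< K (λ k → Σ< (suc k) (λ j → h j (k ∸ j))) ≡ Σ< K (λ j → Σ< (K ∸ j) (h j))
  Σ<-triangle zero h = refl
  Σ<-triangle (suc K) h = begin
    Σ< (suc K) (λ k → Σ< (suc k) (λ j → h j (k ∸ j)))
      ≡⟨ Σ<-init-last K _ ⟩
    Σ< K (λ k → Σ< (suc k) (λ j → h j (k ∸ j))) + Σ< (suc K) (λ j → h j (K ∸ j))
      ≡⟨ cong₂ _+_ (Σ<-triangle K h) (Σ<-init-last K (λ j → h j (K ∸ j))) ⟩
    Σ< K (λ j → Σ< (K ∸ j) (h j)) + (Σ< K (λ j → h j (K ∸ j)) + h K (K ∸ K))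
      ≡⟨ sym (+-assoc (Σ< K (λ j → Σ< (K ∸ j) (h j))) _ _) ⟩
    Σ< K (λ j → Σ< (K ∸ j) (h j)) + Σ< K (λ j → h j (K ∸ j)) + h K (K ∸ K)
      ≡⟨ cong₂ _+_ (sym (Σ<-distrib-+ K (λ j → Σ< (K ∸ j) (h j)) (λ j → h j (K ∸ j))))
                   (cong (h K) (n∸n≡0 K)) ⟩
    Σ< K (λ j → Σ< (K ∸ j) (h j) + h j (K ∸ j)) + h K 0
      ≡⟨ cong₂ _+_ (Σ<-cong K (λ j j<K → trans (sym (Σ<-init-last (K ∸ j) (h j)))
                                            (cong (λ z → Σ< z (h j)) (sym (+-∸-assoc 1 (<⇒≤ j<K))))))
                   (trans (sym (+-identityʳ (h K 0)))
                          (cong (λ z → Σ< z (h K)) (sym (trans (+-∸-assoc 1 {K} ≤-refl) (cong suc (n∸n≡0 K)))))) ⟩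
    Σ< K (λ j → Σ< (suc K ∸ j) (h j)) + Σ< (suc K ∸ K) (h K)
      ≡⟨ sym (Σ<-init-last K (λ j → Σ< (suc K ∸ j) (h j))) ⟩
    Σ< (suc K) (λ j → Σ< (suc K ∸ j) (h j)) ∎

  Σ<-*-Σ<-comm : ∀ a b (B : ℕ → ℕ) (X V : ℕ → ℕ → ℕ) →
    Σ< a (λ j → B j * Σ< b (λ i → X j i * V j i)) ≡ Σ< b (λ i → Σ< a (λ j → X j i * B j * V j i))
  Σ<-*-Σ<-comm a b B X V = begin
    Σ< a (λ j → B j * Σ< b (λ i → X j i * V j i))      ≡⟨ Σ<-cong a (λ j _ → *-distribˡ-Σ< b (B j) (λ i → X j i * V j i)) ⟩
    Σ< a (λ j → Σ< b (λ i → B j * (X j i * V j i)))    ≡⟨ Σ<-comm a b (λ j i → B j * (X j i * V j i)) ⟩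
    Σ< b (λ i → Σ< a (λ j → B j * (X j i * V j i)))    ≡⟨ Σ<-cong b (λ i _ → Σ<-cong a (λ j _ →
                                                            solve 3 (λ b x v → b :* (x :* v) := x :* b :* v) refl (B j) (X j i) (V j i))) ⟩
    Σ< b (λ i → Σ< a (λ j → X j i * B j * V j i))      ∎

  Σ≤-Σ≤≡Σ<-Σ< : ∀ a b (f : ℕ → ℕ → ℕ) → Σ≤ a (λ i → Σ≤ b (f i)) ≡ Σ< (suc a) (λ i → Σ< (suc b) (f i))
  Σ≤-Σ≤≡Σ<-Σ< a b f = trans (Σ≤≡Σ< a (λ i → Σ≤ b (f i))) (Σ<-cong (suc a) (λ i _ → Σ≤≡Σ< b (f i)))

module QNumbers where

  open FiniteSums
  open import Data.Nat using (ℕ; suc; _+_; _*_; _∸_; _^_)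
  open import Data.Nat.Properties using (*-identityʳ; ^-distribˡ-+-*)
  open import Data.Nat.ListAction using (sum; product)
  open import Data.Nat.ListAction.Properties using (product-++)
  open import Data.List using (map; upTo; [_]; _++_)
  open import Data.List.Properties using (map-upTo; upTo-∷ʳ; map-++)
  open import Relation.Binary.PropositionalEquality hiding ([_])
  open ≡-Reasoning

  product-upTo-suc : ∀ n (f : ℕ → ℕ) → product (map f (upTo (suc n))) ≡ product (map f (upTo n)) * f n
  product-upTo-suc n f = begin
    product (map f (upTo (suc n)))        ≡⟨ cong (λ l → product (map f l)) (sym (upTo-∷ʳ n)) ⟩
    product (map f (upTo n ++ [ n ]))     ≡⟨ cong product (map-++ f (upTo n) [ n ]) ⟩
    product (map f (upTo n) ++ [ f n ])   ≡⟨ product-++ (map f (upTo n)) [ f n ] ⟩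
    product (map f (upTo n)) * (f n * 1)  ≡⟨ cong (product (map f (upTo n)) *_) (*-identityʳ (f n)) ⟩
    product (map f (upTo n)) * f n        ∎

  qint≡Σ< : ∀ q a → qint q a ≡ Σ< a (q ^_)
  qint≡Σ< q a = cong sum (map-upTo (q ^_) a)

  qint-+ : ∀ q a b → qint q (a + b) ≡ qint q a + q ^ a * qint q b
  qint-+ q a b = begin
    qint q (a + b)                                ≡⟨ qint≡Σ< q (a + b) ⟩
    Σ< (a + b) (q ^_)                             ≡⟨ Σ<-split a b (q ^_) ⟩
    Σ< a (q ^_) + Σ< b (λ i → q ^ (a + i))        ≡⟨ cong₂ _+_ (sym (qint≡Σ< q a)) (Σ<-cong b (λ i _ → ^-distribˡ-+-* q a i)) ⟩
    qint q a + Σ< b (λ i → q ^ a * q ^ i)         ≡⟨ cong (qint q a +_) (sym (*-distribˡ-Σ< b (q ^ a) (q ^_))) ⟩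
    qint q a + q ^ a * Σ< b (q ^_)                ≡⟨ cong (λ z → qint q a + q ^ a * z) (sym (qint≡Σ< q b)) ⟩
    qint q a + q ^ a * qint q b                   ∎

  Σ<-q^-reversed≡qint : ∀ q n → Σ< n (λ p → q ^ (n ∸ suc p)) ≡ qint q n
  Σ<-q^-reversed≡qint q n = trans (Σ<-reverse n (q ^_)) (sym (qint≡Σ< q n))

  qfact-suc : ∀ q a → qfact q (suc a) ≡ qfact q a * qint q (suc a)
  qfact-suc q a = product-upTo-suc a (λ i → qint q (suc i))

  qrising-suc : ∀ q c b → qrising q c (suc b) ≡ qrising q c b * qint q (c + b)
  qrising-suc q c b = product-upTo-suc b (λ i → qint q (c + i))

module QBinomial where

  open QNumbers
  open import Data.Nat using (ℕ; NonZero; zero; suc; _+_; _*_; _∸_; _^_; _≤_; _<_; s≤s; _≤ᵇ_; _/_)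
  open import Data.Nat.Properties
  open import Data.Nat.DivMod using (m*n/n≡m)
  open import Data.Nat.Solver using (module +-*-Solver)
  open import Data.Bool using (true; false; T)
  open import Relation.Binary.PropositionalEquality
  open +-*-Solver using (solve; _:=_; _:+_; _:*_)
  open ≡-Reasoning

  -- qbinom is defined by a division; the proofs work with this recursive form instead.
  qPascal : ℕ → ℕ → ℕ → ℕ
  qPascal q n zero = 1
  qPascal q zero (suc k) = 0
  qPascal q (suc n) (suc k) = qPascal q n (suc k) + q ^ (n ∸ k) * qPascal q n k

  n<k⇒qPascal≡0 : ∀ q {n k} → n < k → qPascal q n k ≡ 0
  n<k⇒qPascal≡0 q {zero} {suc k} _ = refl
  n<k⇒qPascal≡0 q {suc n} {suc k} (s≤s n<k)
    rewrite n<k⇒qPascal≡0 q (m<n⇒m<1+n n<k) | n<k⇒qPascal≡0 q n<k = *-zeroʳ (q ^ (n ∸ k))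

  qPascal-n-n : ∀ q n → qPascal q n n ≡ 1
  qPascal-n-n q zero = refl
  qPascal-n-n q (suc n) rewrite n<k⇒qPascal≡0 q (n<1+n n) | n∸n≡0 n | qPascal-n-n q n = refl

  qPascal-*-qfact : ∀ q k d → qPascal q (k + d) k * (qfact q k * qfact q d) ≡ qfact q (k + d)
  qPascal-*-qfact q zero d = trans (*-identityˡ _) (*-identityˡ _)
  qPascal-*-qfact q (suc k) zero rewrite +-identityʳ k | qPascal-n-n q (suc k) =
    trans (*-identityˡ _) (*-identityʳ _)
  qPascal-*-qfact q (suc k) (suc d) = begin
    (A + q ^ (n ∸ k) * B) * (qfact q (suc k) * qfact q (suc d))
      ≡⟨ cong₂ (λ u v → (A + q ^ u * B) * v) (m+n∸m≡n k (suc d)) (cong₂ _*_ (qfact-suc q k) (qfact-suc q d)) ⟩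
    (A + q ^ suc d * B) * ((k! * [k+1]) * (d! * [d+1]))
      ≡⟨ solve 7 (λ A B k! [k+1] d! [d+1] Q → (A :+ Q :* B) :* ((k! :* [k+1]) :* (d! :* [d+1]))
                   := (A :* ((k! :* [k+1]) :* d!)) :* [d+1] :+ (B :* (k! :* (d! :* [d+1]))) :* (Q :* [k+1]))
                 refl A B k! [k+1] d! [d+1] (q ^ suc d) ⟩
    (A * ((k! * [k+1]) * d!)) * [d+1] + (B * (k! * (d! * [d+1]))) * (q ^ suc d * [k+1])
      ≡⟨ cong₂ (λ u v → u * [d+1] + v * (q ^ suc d * [k+1])) first second ⟩
    qfact q n * [d+1] + qfact q n * (q ^ suc d * [k+1])
      ≡⟨ sym (*-distribˡ-+ (qfact q n) [d+1] _) ⟩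
    qfact q n * ([d+1] + q ^ suc d * [k+1])
      ≡⟨ cong (qfact q n *_) (sym (qint-+ q (suc d) (suc k))) ⟩
    qfact q n * qint q (suc d + suc k)
      ≡⟨ cong (λ u → qfact q n * qint q u) (+-comm (suc d) (suc k)) ⟩
    qfact q n * qint q (suc n)
      ≡⟨ sym (qfact-suc q n) ⟩
    qfact q (suc n) ∎
    where
    n = k + suc d
    A = qPascal q n (suc k)
    B = qPascal q n k
    k! = qfact q k
    d! = qfact q d
    [k+1] = qint q (suc k)
    [d+1] = qint q (suc d)
    first : A * ((k! * [k+1]) * d!) ≡ qfact q n
    first = begin
      A * ((k! * [k+1]) * d!)                        ≡⟨ cong₂ (λ u v → qPascal q u (suc k) * (v * d!)) (+-suc k d) (sym (qfact-suc q k)) ⟩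
      qPascal q (suc k + d) (suc k) * (qfact q (suc k) * d!) ≡⟨ qPascal-*-qfact q (suc k) d ⟩
      qfact q (suc (k + d))                          ≡⟨ cong (qfact q) (sym (+-suc k d)) ⟩
      qfact q n                                      ∎
    second : B * (k! * (d! * [d+1])) ≡ qfact q n
    second = trans (cong (λ v → B * (k! * v)) (sym (qfact-suc q d))) (qPascal-*-qfact q k (suc d))

  qbinom≡qPascal : ∀ q n k → qbinom q n k ≡ qPascal q n k
  qbinom≡qPascal q n k with k ≤ᵇ n in eq
  ... | true = trans (cong (λ z → (z / (qfact q k * qfact q (n ∸ k))) {{nz}}) (sym qPascal-*-qfacts))
                     (m*n/n≡m (qPascal q n k) _ {{nz}})
    where
    k≤n : k ≤ n
    k≤n = ≤ᵇ⇒≤ k n (subst T (sym eq) _)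
    nz : NonZero (qfact q k * qfact q (n ∸ k))
    nz = m*n≢0 (qfact q k) (qfact q (n ∸ k)) {{qfact-nz q k}} {{qfact-nz q (n ∸ k)}}
    qPascal-*-qfacts : qPascal q n k * (qfact q k * qfact q (n ∸ k)) ≡ qfact q n
    qPascal-*-qfacts = subst (λ z → qPascal q z k * (qfact q k * qfact q (n ∸ k)) ≡ qfact q z)
                             (m+[n∸m]≡n k≤n) (qPascal-*-qfact q k (n ∸ k))
  ... | false = sym (n<k⇒qPascal≡0 q {n} {k} (≰⇒> (λ k≤n → subst T eq (≤⇒≤ᵇ k≤n))))

  qbinom-n-0 : ∀ q n → qbinom q n 0 ≡ 1
  qbinom-n-0 q n = qbinom≡qPascal q n 0

  n<k⇒qbinom≡0 : ∀ q {n k} → n < k → qbinom q n k ≡ 0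
  n<k⇒qbinom≡0 q {n} {k} n<k = trans (qbinom≡qPascal q n k) (n<k⇒qPascal≡0 q n<k)

  qbinom-pascal : ∀ q n i → qbinom q (suc n) (suc i) ≡ qbinom q n (suc i) + q ^ (n ∸ i) * qbinom q n i
  qbinom-pascal q n i
    rewrite qbinom≡qPascal q (suc n) (suc i) | qbinom≡qPascal q n (suc i) | qbinom≡qPascal q n i = refl

module LahArrays (q : ℕ) where

  open FiniteSums
  open QNumbers
  open QBinomial
  open import Data.Nat using (ℕ; zero; suc; _+_; _*_; _∸_; _^_; _≤_; _<_; s≤s)
  open import Data.Nat.Properties
  open import Relation.Nullary using (yes; no)
  open import Data.Nat.Solver using (module +-*-Solver)
  open import Relation.Binary.PropositionalEquality
  open +-*-Solver using (solve; _:=_; _:+_; _:*_; con)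
  open ≡-Reasoning

  record IsLahArray (s : ℕ) (T : ℕ → ℕ → ℕ) : Set where
    field
      step-zero : ∀ n → T (suc n) 0 ≡ qint q (s + n) * T n 0
      step-suc  : ∀ n k → T (suc n) (suc k) ≡ q ^ (s + n + k) * T n k + qint q (suc (s + n + k)) * T n (suc k)

  open IsLahArray

  LowerTriangular : (ℕ → ℕ → ℕ) → Set
  LowerTriangular T = ∀ {n k} → n < k → T n k ≡ 0

  lahArray-unique : ∀ {s T U} → IsLahArray s T → IsLahArray s U → (∀ k → T 0 k ≡ U 0 k) → ∀ n k → T n k ≡ U n k
  lahArray-unique t u row₀ zero k = row₀ k
  lahArray-unique {s} t u row₀ (suc n) zero =
    trans (step-zero t n) (trans (cong (qint q (s + n) *_) (lahArray-unique t u row₀ n 0)) (sym (step-zero u n)))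
  lahArray-unique {s} t u row₀ (suc n) (suc k) =
    trans (step-suc t n k)
      (trans (cong₂ (λ a b → q ^ (s + n + k) * a + qint q (suc (s + n + k)) * b)
                    (lahArray-unique t u row₀ n k) (lahArray-unique t u row₀ n (suc k)))
             (sym (step-suc u n k)))

  lahArray-dropRows : ∀ {s T} m → IsLahArray s T → IsLahArray (m + s) (λ n k → T (m + n) k)
  lahArray-dropRows {s} {T} m t = record
    { step-zero = λ n → begin
        T (m + suc n) 0                        ≡⟨ cong (λ z → T z 0) (+-suc m n) ⟩
        T (suc (m + n)) 0                      ≡⟨ step-zero t (m + n) ⟩
        qint q (s + (m + n)) * T (m + n) 0     ≡⟨ cong (λ z → qint q z * T (m + n) 0) (shift n) ⟩
        qint q (m + s + n) * T (m + n) 0       ∎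
    ; step-suc = λ n k → begin
        T (m + suc n) (suc k)                  ≡⟨ cong (λ z → T z (suc k)) (+-suc m n) ⟩
        T (suc (m + n)) (suc k)                ≡⟨ step-suc t (m + n) k ⟩
        q ^ (s + (m + n) + k) * T (m + n) k + qint q (suc (s + (m + n) + k)) * T (m + n) (suc k)
          ≡⟨ cong (λ z → q ^ (z + k) * T (m + n) k + qint q (suc (z + k)) * T (m + n) (suc k)) (shift n) ⟩
        q ^ (m + s + n + k) * T (m + n) k + qint q (suc (m + s + n + k)) * T (m + n) (suc k) ∎
    }
    where
    shift : ∀ n → s + (m + n) ≡ m + s + n
    shift n = solve 3 (λ s m n → s :+ (m :+ n) := m :+ s :+ n) refl s m n

  column-zero-vanishes : ∀ {T} → IsLahArray 0 T → ∀ n → T (suc n) 0 ≡ 0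
  column-zero-vanishes t zero = step-zero t 0
  column-zero-vanishes t (suc n) =
    trans (step-zero t (suc n)) (trans (cong (qint q (suc n) *_) (column-zero-vanishes t n)) (*-zeroʳ (qint q (suc n))))

  lahCoeff : ℕ → ℕ → ℕ → ℕ
  lahCoeff c n i = q ^ (i * c) * qrising q c (n ∸ i) * qbinom q n i

  lahTransform : ℕ → (ℕ → ℕ → ℕ) → ℕ → ℕ → ℕ
  lahTransform c T n l = Σ< (suc n) (λ i → lahCoeff c n i * T i l)

  lahCoeff-zero : ∀ c n → lahCoeff c n 0 ≡ qrising q c n
  lahCoeff-zero c n rewrite qbinom-n-0 q n = trans (*-identityʳ _) (+-identityʳ _)

  lahCoeff-suc-zero : ∀ c n → lahCoeff c (suc n) 0 ≡ qint q (c + n) * lahCoeff c n 0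
  lahCoeff-suc-zero c n rewrite lahCoeff-zero c (suc n) | lahCoeff-zero c n =
    trans (qrising-suc q c n) (*-comm (qrising q c n) _)

  qrising-*-qbinom-suc : ∀ c n i →
    qrising q c (n ∸ i) * qbinom q n (suc i) ≡ qrising q c (n ∸ suc i) * qint q (c + (n ∸ suc i)) * qbinom q n (suc i)
  qrising-*-qbinom-suc c n i with suc i ≤? n
  ... | yes i<n = cong (_* qbinom q n (suc i))
                    (trans (cong (qrising q c) (+-∸-assoc 1 i<n)) (qrising-suc q c (n ∸ suc i)))
  ... | no i≮n rewrite n<k⇒qbinom≡0 q (≰⇒> i≮n) =
    trans (*-zeroʳ (qrising q c (n ∸ i))) (sym (*-zeroʳ (qrising q c (n ∸ suc i) * qint q (c + (n ∸ suc i)))))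

  lahCoeff-suc-suc : ∀ c n i →
    lahCoeff c (suc n) (suc i) ≡ qint q (c + (n ∸ suc i)) * lahCoeff c n (suc i) + q ^ (c + (n ∸ i)) * lahCoeff c n i
  lahCoeff-suc-suc c n i = begin
    q ^ (c + i * c) * R * qbinom q (suc n) (suc i)
      ≡⟨ cong₂ (λ a b → a * R * b) (^-distribˡ-+-* q c (i * c)) (qbinom-pascal q n i) ⟩
    Qc * Qic * R * (B₁ + Qd * B₀)
      ≡⟨ solve 6 (λ Qc Qic R B₁ Qd B₀ → Qc :* Qic :* R :* (B₁ :+ Qd :* B₀)
                   := Qc :* Qic :* (R :* B₁) :+ Qc :* Qd :* (Qic :* R :* B₀)) refl Qc Qic R B₁ Qd B₀ ⟩
    Qc * Qic * (R * B₁) + Qc * Qd * (Qic * R * B₀)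
      ≡⟨ cong (λ z → Qc * Qic * z + Qc * Qd * (Qic * R * B₀)) (qrising-*-qbinom-suc c n i) ⟩
    Qc * Qic * (R′ * I * B₁) + Qc * Qd * (Qic * R * B₀)
      ≡⟨ cong₂ (λ a b → a * (R′ * I * B₁) + b * (Qic * R * B₀))
               (sym (^-distribˡ-+-* q c (i * c))) (sym (^-distribˡ-+-* q c (n ∸ i))) ⟩
    q ^ (c + i * c) * (R′ * I * B₁) + q ^ (c + (n ∸ i)) * (Qic * R * B₀)
      ≡⟨ cong (_+ q ^ (c + (n ∸ i)) * (Qic * R * B₀))
              (solve 4 (λ Q R′ I B₁ → Q :* (R′ :* I :* B₁) := I :* (Q :* R′ :* B₁)) refl (q ^ (c + i * c)) R′ I B₁) ⟩
    I * lahCoeff c n (suc i) + q ^ (c + (n ∸ i)) * lahCoeff c n i ∎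
    where
    Qc = q ^ c
    Qic = q ^ (i * c)
    Qd = q ^ (n ∸ i)
    R = qrising q c (n ∸ i)
    R′ = qrising q c (n ∸ suc i)
    I = qint q (c + (n ∸ suc i))
    B₁ = qbinom q n (suc i)
    B₀ = qbinom q n i

  lahTransform-row-zero : ∀ c T l → lahTransform c T 0 l ≡ T 0 l
  lahTransform-row-zero c T l = trans (+-identityʳ _) (+-identityʳ _)  -- lahCoeff c 0 0 computes to 1

  lahTransform-lowerTriangular : ∀ {T} c → LowerTriangular T → LowerTriangular (lahTransform c T)
  lahTransform-lowerTriangular {T} c vanish {n} {l} n<l =
    Σ<-zero (suc n) _ (λ i i≤n → trans (cong (lahCoeff c n i *_) (vanish (≤-<-trans (≤-pred i≤n) n<l))) (*-zeroʳ (lahCoeff c n i)))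

  module _ {T : ℕ → ℕ → ℕ} (t : IsLahArray 0 T) (c : ℕ) where

    lahTransform-column-zero : ∀ n → lahTransform c T n 0 ≡ qrising q c n * T 0 0
    lahTransform-column-zero n = begin
      lahCoeff c n 0 * T 0 0 + Σ< n (λ i → lahCoeff c n (suc i) * T (suc i) 0)
        ≡⟨ cong₂ _+_ (cong (_* T 0 0) (lahCoeff-zero c n))
                     (Σ<-zero n _ (λ i _ → trans (cong (lahCoeff c n (suc i) *_) (column-zero-vanishes t i))
                                                 (*-zeroʳ (lahCoeff c n (suc i))))) ⟩
      qrising q c n * T 0 0 + 0
        ≡⟨ +-identityʳ _ ⟩
      qrising q c n * T 0 0 ∎

    private
      X : ℕ → ℕ → ℕ
      X n i = lahCoeff c n i

      rebalance : ∀ {i n} l → i ≤ n → c + (n ∸ i) + (i + l) ≡ c + n + l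
      rebalance {i} {n} l i≤n = begin
        c + (n ∸ i) + (i + l)  ≡⟨ solve 4 (λ c d i l → c :+ d :+ (i :+ l) := c :+ (i :+ d) :+ l) refl c (n ∸ i) i l ⟩
        c + (i + (n ∸ i)) + l  ≡⟨ cong (λ z → c + z + l) (m+[n∸m]≡n i≤n) ⟩
        c + n + l              ∎

    lahTransform-step-suc : ∀ n l →
      lahTransform c T (suc n) (suc l) ≡ q ^ (c + n + l) * lahTransform c T n l + qint q (suc (c + n + l)) * lahTransform c T n (suc l)
    lahTransform-step-suc n l = begin
      X (suc n) 0 * T 0 (suc l) + Σ< (suc n) (λ i → X (suc n) (suc i) * T (suc i) (suc l))
        ≡⟨ cong₂ _+_ (cong (_* T 0 (suc l)) (lahCoeff-suc-zero c n))
                     (trans (Σ<-cong (suc n) (λ i _ → split i)) (Σ<-distrib-+ (suc n) (λ i → Z (suc i)) Y)) ⟩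
      Z 0 + (Σ< (suc n) (λ i → Z (suc i)) + Σ< (suc n) Y)
        ≡⟨ sym (+-assoc (Z 0) _ _) ⟩
      Σ< (suc (suc n)) Z + Σ< (suc n) Y
        ≡⟨ cong (_+ Σ< (suc n) Y) (trans (Σ<-init-last (suc n) Z) (trans (cong (Σ< (suc n) Z +_) Z-last) (+-identityʳ _))) ⟩
      Σ< (suc n) Z + Σ< (suc n) Y
        ≡⟨ sym (Σ<-distrib-+ (suc n) Z Y) ⟩
      Σ< (suc n) (λ i → Z i + Y i)
        ≡⟨ Σ<-cong (suc n) (λ i i<sn → regroup i (≤-pred i<sn)) ⟩
      Σ< (suc n) (λ i → q ^ (c + n + l) * (X n i * T i l) + qint q (suc (c + n + l)) * (X n i * T i (suc l)))
        ≡⟨ Σ<-distrib-+ (suc n) (λ i → q ^ (c + n + l) * (X n i * T i l)) (λ i → qint q (suc (c + n + l)) * (X n i * T i (suc l))) ⟩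
      Σ< (suc n) (λ i → q ^ (c + n + l) * (X n i * T i l)) + Σ< (suc n) (λ i → qint q (suc (c + n + l)) * (X n i * T i (suc l)))
        ≡⟨ sym (cong₂ _+_ (*-distribˡ-Σ< (suc n) (q ^ (c + n + l)) (λ i → X n i * T i l))
                        (*-distribˡ-Σ< (suc n) (qint q (suc (c + n + l))) (λ i → X n i * T i (suc l)))) ⟩
      q ^ (c + n + l) * lahTransform c T n l + qint q (suc (c + n + l)) * lahTransform c T n (suc l) ∎
      where
      Z : ℕ → ℕ
      Z i = qint q (c + (n ∸ i)) * X n i * T i (suc l)
      Y : ℕ → ℕ
      Y i = q ^ (c + (n ∸ i)) * X n i * T (suc i) (suc l)
      split : ∀ i → X (suc n) (suc i) * T (suc i) (suc l) ≡ Z (suc i) + Y i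
      split i = trans (cong (_* T (suc i) (suc l)) (lahCoeff-suc-suc c n i))
        (solve 5 (λ a x b y t → (a :* x :+ b :* y) :* t := a :* x :* t :+ b :* y :* t) refl
               (qint q (c + (n ∸ suc i))) (X n (suc i)) (q ^ (c + (n ∸ i))) (X n i) (T (suc i) (suc l)))
      Z-last : Z (suc n) ≡ 0
      Z-last rewrite n<k⇒qbinom≡0 q (n<1+n n) =
        trans (cong (λ z → qint q (c + (n ∸ suc n)) * z * T (suc n) (suc l)) (*-zeroʳ (q ^ (suc n * c) * qrising q c (n ∸ suc n))))
              (cong (_* T (suc n) (suc l)) (*-zeroʳ (qint q (c + (n ∸ suc n)))))
      regroup : ∀ i → i ≤ n → Z i + Y i ≡ q ^ (c + n + l) * (X n i * T i l) + qint q (suc (c + n + l)) * (X n i * T i (suc l))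
      regroup i i≤n = begin
        Z i + Y i
          ≡⟨ cong (λ z → Z i + q ^ a * X n i * z) (step-suc t i l) ⟩
        qint q a * X n i * T i (suc l) + q ^ a * X n i * (q ^ (i + l) * T i l + qint q (suc (i + l)) * T i (suc l))
          ≡⟨ solve 7 (λ I x u Q E v J → I :* x :* u :+ Q :* x :* (E :* v :+ J :* u)
                       := (Q :* E) :* (x :* v) :+ (I :+ Q :* J) :* (x :* u)) refl
                   (qint q a) (X n i) (T i (suc l)) (q ^ a) (q ^ (i + l)) (T i l) (qint q (suc (i + l))) ⟩
        (q ^ a * q ^ (i + l)) * (X n i * T i l) + (qint q a + q ^ a * qint q (suc (i + l))) * (X n i * T i (suc l))
          ≡⟨ cong₂ (λ u v → u * (X n i * T i l) + v * (X n i * T i (suc l))) power index ⟩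
        q ^ (c + n + l) * (X n i * T i l) + qint q (suc (c + n + l)) * (X n i * T i (suc l)) ∎
        where
        a = c + (n ∸ i)
        power : q ^ a * q ^ (i + l) ≡ q ^ (c + n + l)
        power = trans (sym (^-distribˡ-+-* q a (i + l))) (cong (q ^_) (rebalance l i≤n))
        index : qint q a + q ^ a * qint q (suc (i + l)) ≡ qint q (suc (c + n + l))
        index = trans (sym (qint-+ q a (suc (i + l))))
                      (cong (qint q) (trans (+-suc a (i + l)) (cong suc (rebalance l i≤n))))

    lahTransform-isLahArray : IsLahArray c (lahTransform c T)
    lahTransform-isLahArray = record
      { step-zero = λ n → begin
          lahTransform c T (suc n) 0          ≡⟨ lahTransform-column-zero (suc n) ⟩
          qrising q c (suc n) * T 0 0         ≡⟨ cong (_* T 0 0) (qrising-suc q c n) ⟩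
          qrising q c n * qint q (c + n) * T 0 0
            ≡⟨ solve 3 (λ r i t → r :* i :* t := i :* (r :* t)) refl (qrising q c n) (qint q (c + n)) (T 0 0) ⟩
          qint q (c + n) * (qrising q c n * T 0 0) ≡⟨ cong (qint q (c + n) *_) (sym (lahTransform-column-zero n)) ⟩
          qint q (c + n) * lahTransform c T n 0 ∎
      ; step-suc = lahTransform-step-suc
      }

  Σ<-lahTransform : ∀ {T} c n → LowerTriangular T →
    Σ< (suc n) (lahTransform c T n) ≡ Σ< (suc n) (λ i → lahCoeff c n i * Σ< (suc i) (T i))
  Σ<-lahTransform {T} c n vanish = begin
    Σ< (suc n) (λ l → Σ< (suc n) (λ i → lahCoeff c n i * T i l))
      ≡⟨ Σ<-comm (suc n) (suc n) (λ l i → lahCoeff c n i * T i l) ⟩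
    Σ< (suc n) (λ i → Σ< (suc n) (λ l → lahCoeff c n i * T i l))
      ≡⟨ Σ<-cong (suc n) (λ i i≤n → trans (sym (*-distribˡ-Σ< (suc n) (lahCoeff c n i) (T i)))
                                          (cong (lahCoeff c n i *_) (Σ<-truncate (T i) i≤n (λ l i<l → vanish i<l)))) ⟩
    Σ< (suc n) (λ i → lahCoeff c n i * Σ< (suc i) (T i)) ∎

  convolution : (ℕ → ℕ) → (ℕ → ℕ → ℕ → ℕ) → ℕ → ℕ → ℕ
  convolution B F n k = Σ< (suc k) (λ j → B j * F j n (k ∸ j))

  convolution-row-zero : ∀ B F → (∀ j → F j 0 0 ≡ 1) → (∀ j {l} → 0 < l → F j 0 l ≡ 0) →
    ∀ k → convolution B F 0 k ≡ B k
  convolution-row-zero B F diagonal off-diagonal k = begin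
    Σ< (suc k) (λ j → B j * F j 0 (k ∸ j))
      ≡⟨ Σ<-init-last k (λ j → B j * F j 0 (k ∸ j)) ⟩
    Σ< k (λ j → B j * F j 0 (k ∸ j)) + B k * F k 0 (k ∸ k)
      ≡⟨ cong₂ _+_ (Σ<-zero k _ (λ j j<k → trans (cong (B j *_) (off-diagonal j (m<n⇒0<n∸m j<k))) (*-zeroʳ (B j))))
                   (trans (cong (λ z → B k * F k 0 z) (n∸n≡0 k)) (trans (cong (B k *_) (diagonal k)) (*-identityʳ (B k)))) ⟩
    B k ∎

  module _ {s : ℕ} (B : ℕ → ℕ) {F : ℕ → ℕ → ℕ → ℕ} (lah : ∀ j → IsLahArray (j + s) (F j)) where

    convolution-step-suc : ∀ n k → convolution B F (suc n) (suc k) ≡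
      q ^ (s + n + k) * convolution B F n k + qint q (suc (s + n + k)) * convolution B F n (suc k)
    convolution-step-suc n k = begin
      Σ< (suc (suc k)) P′
        ≡⟨ Σ<-init-last (suc k) P′ ⟩
      Σ< (suc k) P′ + P′ (suc k)
        ≡⟨ cong₂ _+_ (trans (Σ<-cong (suc k) (λ j j<sk → inner j (≤-pred j<sk)))
                            (Σ<-distrib-+ (suc k) (λ j → E * P j) (λ j → I * P₁ j))) last ⟩
      Σ< (suc k) (λ j → E * P j) + Σ< (suc k) (λ j → I * P₁ j) + I * P₁ (suc k)
        ≡⟨ +-assoc (Σ< (suc k) (λ j → E * P j)) _ _ ⟩
      Σ< (suc k) (λ j → E * P j) + (Σ< (suc k) (λ j → I * P₁ j) + I * P₁ (suc k))
        ≡⟨ cong₂ _+_ (sym (*-distribˡ-Σ< (suc k) E P))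
                     (trans (cong (_+ I * P₁ (suc k)) (sym (*-distribˡ-Σ< (suc k) I P₁)))
                            (trans (sym (*-distribˡ-+ I (Σ< (suc k) P₁) (P₁ (suc k)))) (cong (I *_) (sym (Σ<-init-last (suc k) P₁))))) ⟩
      E * convolution B F n k + I * convolution B F n (suc k) ∎
      where
      E = q ^ (s + n + k)
      I = qint q (suc (s + n + k))
      P′ P P₁ : ℕ → ℕ
      P′ j = B j * F j (suc n) (suc k ∸ j)
      P j = B j * F j n (k ∸ j)
      P₁ j = B j * F j n (suc k ∸ j)
      rebalance : ∀ {j} → j ≤ k → j + s + n + (k ∸ j) ≡ s + n + k
      rebalance {j} j≤k = begin
        j + s + n + (k ∸ j)    ≡⟨ solve 4 (λ j s n d → j :+ s :+ n :+ d := s :+ n :+ (j :+ d)) refl j s n (k ∸ j) ⟩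
        s + n + (j + (k ∸ j))  ≡⟨ cong (s + n +_) (m+[n∸m]≡n j≤k) ⟩
        s + n + k              ∎
      inner : ∀ j → j ≤ k → P′ j ≡ E * P j + I * P₁ j
      inner j j≤k = begin
        B j * F j (suc n) (suc k ∸ j)
          ≡⟨ cong (λ z → B j * F j (suc n) z) (+-∸-assoc 1 j≤k) ⟩
        B j * F j (suc n) (suc (k ∸ j))
          ≡⟨ cong (B j *_) (IsLahArray.step-suc (lah j) n (k ∸ j)) ⟩
        B j * (q ^ (j + s + n + (k ∸ j)) * F j n (k ∸ j) + qint q (suc (j + s + n + (k ∸ j))) * F j n (suc (k ∸ j)))
          ≡⟨ cong₂ (λ a b → B j * (q ^ a * F j n (k ∸ j) + qint q (suc a) * F j n b))
                   (rebalance j≤k) (sym (+-∸-assoc 1 j≤k)) ⟩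
        B j * (E * F j n (k ∸ j) + I * F j n (suc k ∸ j))
          ≡⟨ solve 5 (λ b e f i g → b :* (e :* f :+ i :* g) := e :* (b :* f) :+ i :* (b :* g)) refl
                   (B j) E (F j n (k ∸ j)) I (F j n (suc k ∸ j)) ⟩
        E * P j + I * P₁ j ∎
      last : P′ (suc k) ≡ I * P₁ (suc k)
      last = begin
        B (suc k) * F (suc k) (suc n) (k ∸ k)
          ≡⟨ cong (λ z → B (suc k) * F (suc k) (suc n) z) (n∸n≡0 k) ⟩
        B (suc k) * F (suc k) (suc n) 0
          ≡⟨ cong (B (suc k) *_) (IsLahArray.step-zero (lah (suc k)) n) ⟩
        B (suc k) * (qint q (suc k + s + n) * F (suc k) n 0)
          ≡⟨ cong (λ a → B (suc k) * (qint q a * F (suc k) n 0))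
                  (solve 3 (λ k s n → con 1 :+ k :+ s :+ n := con 1 :+ (s :+ n :+ k)) refl k s n) ⟩
        B (suc k) * (I * F (suc k) n 0)
          ≡⟨ solve 3 (λ b i f → b :* (i :* f) := i :* (b :* f)) refl (B (suc k)) I (F (suc k) n 0) ⟩
        I * (B (suc k) * F (suc k) n 0)
          ≡⟨ cong (λ z → I * (B (suc k) * F (suc k) n z)) (sym (n∸n≡0 k)) ⟩
        I * P₁ (suc k) ∎

    convolution-isLahArray : IsLahArray s (convolution B F)
    convolution-isLahArray = record
      { step-zero = λ n → trans (cong (λ z → B 0 * z + 0) (IsLahArray.step-zero (lah 0) n))
          (solve 3 (λ b i f → b :* (i :* f) :+ con 0 := i :* (b :* f :+ con 0)) refl (B 0) (qint q (s + n)) (F 0 n 0))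
      ; step-suc = convolution-step-suc
      }

  Σ<-convolution : ∀ {m n} B F → (∀ {j} → m < j → B j ≡ 0) → (∀ j {l} → n < l → F j n l ≡ 0) →
    Σ< (suc (m + n)) (convolution B F n) ≡ Σ< (suc m) (λ j → B j * Σ< (suc n) (F j n))
  Σ<-convolution {m} {n} B F B-vanish F-vanish = begin
    Σ< (suc (m + n)) (λ k → Σ< (suc k) (λ j → h j (k ∸ j)))
      ≡⟨ Σ<-triangle (suc (m + n)) h ⟩
    Σ< (suc (m + n)) (λ j → Σ< (suc (m + n) ∸ j) (h j))
      ≡⟨ Σ<-truncate (λ j → Σ< (suc (m + n) ∸ j) (h j)) (s≤s (m≤m+n m n))
                     (λ j m<j → Σ<-zero (suc (m + n) ∸ j) (h j) (λ l _ → cong (_* F j n l) (B-vanish m<j))) ⟩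
    Σ< (suc m) (λ j → Σ< (suc (m + n) ∸ j) (h j))
      ≡⟨ Σ<-cong (suc m) (λ j j<sm → row j (≤-pred j<sm)) ⟩
    Σ< (suc m) (λ j → B j * Σ< (suc n) (F j n)) ∎
    where
    h : ℕ → ℕ → ℕ
    h j l = B j * F j n l
    row : ∀ j → j ≤ m → Σ< (suc (m + n) ∸ j) (h j) ≡ B j * Σ< (suc n) (F j n)
    row j j≤m = trans (Σ<-truncate (h j) bound (λ l n<l → trans (cong (B j *_) (F-vanish j n<l)) (*-zeroʳ (B j))))
                      (sym (*-distribˡ-Σ< (suc n) (B j) (F j n)))
      where
      bound : suc n ≤ suc (m + n) ∸ j
      bound = m+n≤o⇒m≤o∸n (suc n) (s≤s (subst (n + j ≤_) (+-comm n m) (+-monoʳ-≤ n j≤m)))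

module ListSums where

  open import Data.Nat using (ℕ; _+_; _*_)
  open import Data.Nat.Properties using (*-zeroʳ; *-distribˡ-+)
  open import Data.Nat.ListAction using (sum)
  open import Data.Nat.ListAction.Properties using (sum-↭; sum-++)
  open import Data.Bool using (Bool; true; false; T; if_then_else_)
  open import Data.Product using (_×_; _,_; proj₁; proj₂; Σ)
  open import Data.List using (List; []; _∷_; map; _++_; filterᵇ; cartesianProduct)
  open import Data.List.Properties using (map-++; map-∘)
  open import Data.List.Relation.Unary.All using (All; []; _∷_)
  open import Data.List.Relation.Unary.Any using (here; there)
  open import Data.List.Relation.Unary.Unique.Propositional using (Unique)
  open import Data.List.Relation.Unary.AllPairs using ([]; _∷_)
  import Data.List.Relation.Unary.Unique.Propositional.Properties as Unique
  open import Data.List.Membership.Propositional using (_∈_)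
  open import Data.List.Membership.Propositional.Properties using (∈-filter⁻; ∈-filter⁺; ∈-map⁺; ∈-map⁻)
  open import Data.List.Membership.Propositional.Properties.WithK using (unique∧set⇒bag)
  open import Data.List.Relation.Binary.BagAndSetEquality using (∼bag⇒↭)
  open import Data.List.Relation.Binary.Permutation.Propositional using (_↭_)
  import Data.List.Relation.Binary.Permutation.Propositional.Properties as Permutation
  open import Function.Bundles using (mk⇔)
  open import Relation.Binary.PropositionalEquality
  open import Relation.Nullary using (¬_)

  sum-map-if : ∀ {A : Set} (P : A → Bool) (w : A → ℕ) xs →
    sum (map (λ x → if P x then w x else 0) xs) ≡ sum (map w (filterᵇ P xs))
  sum-map-if P w [] = refl
  sum-map-if P w (x ∷ xs) with P x
  ... | true = cong (w x +_) (sum-map-if P w xs)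
  ... | false = sum-map-if P w xs

  sum-map-cong-∈ : ∀ {A : Set} {f g : A → ℕ} xs → (∀ {x} → x ∈ xs → f x ≡ g x) → sum (map f xs) ≡ sum (map g xs)
  sum-map-cong-∈ [] h = refl
  sum-map-cong-∈ (x ∷ xs) h = cong₂ _+_ (h (here refl)) (sum-map-cong-∈ xs (λ m → h (there m)))

  sum-map-zero-∈ : ∀ {A : Set} {f : A → ℕ} xs → (∀ {x} → x ∈ xs → f x ≡ 0) → sum (map f xs) ≡ 0
  sum-map-zero-∈ [] h = refl
  sum-map-zero-∈ (x ∷ xs) h = cong₂ _+_ (h (here refl)) (sum-map-zero-∈ xs (λ m → h (there m)))

  sum-map-*ˡ : ∀ {A : Set} (c : ℕ) (f : A → ℕ) xs → sum (map (λ x → c * f x) xs) ≡ c * sum (map f xs)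
  sum-map-*ˡ c f [] = sym (*-zeroʳ c)
  sum-map-*ˡ c f (x ∷ xs) = trans (cong (c * f x +_) (sum-map-*ˡ c f xs)) (sym (*-distribˡ-+ c (f x) _))

  sum-map-++ : ∀ {A : Set} (f : A → ℕ) xs ys → sum (map f (xs ++ ys)) ≡ sum (map f xs) + sum (map f ys)
  sum-map-++ f xs ys = trans (cong sum (map-++ f xs ys)) (sum-++ (map f xs) (map f ys))

  sum-map-cartesianProduct : ∀ {A B : Set} (f : A × B → ℕ) xs ys →
    sum (map f (cartesianProduct xs ys)) ≡ sum (map (λ x → sum (map (λ y → f (x , y)) ys)) xs)
  sum-map-cartesianProduct f [] ys = refl
  sum-map-cartesianProduct f (x ∷ xs) ys = trans (sum-map-++ f (map (x ,_) ys) _)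
    (cong₂ _+_ (cong sum (sym (map-∘ ys))) (sum-map-cartesianProduct f xs ys))

  Unique-map-injectiveOn : ∀ {A B : Set} (φ : B → A) {ys} → (∀ {y y′} → y ∈ ys → y′ ∈ ys → φ y ≡ φ y′ → y ≡ y′) →
    Unique ys → Unique (map φ ys)
  Unique-map-injectiveOn φ {[]} _ _ = []
  Unique-map-injectiveOn φ {y ∷ ys} inj (y∉ys ∷ u) = head ys y∉ys (λ m → m) ∷ Unique-map-injectiveOn φ (λ m m′ → inj (there m) (there m′)) u
    where
    head : ∀ zs → All (λ z → ¬ y ≡ z) zs → (∀ {z} → z ∈ zs → z ∈ ys) → All (λ a → ¬ φ y ≡ a) (map φ zs)
    head [] _ _ = []
    head (z ∷ zs) (y≢z ∷ ns) sub = (λ e → y≢z (inj (here refl) (there (sub (here refl))) e)) ∷ head zs ns (λ m → sub (there m))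

  sum-filter-bijection : ∀ {A B : Set} {xs : List A} {ys : List B} (P : A → Bool) (w : A → ℕ) (φ : B → A) →
    Unique xs → Unique ys →
    (∀ {y y′} → y ∈ ys → y′ ∈ ys → φ y ≡ φ y′ → y ≡ y′) →
    (∀ {y} → y ∈ ys → φ y ∈ xs × T (P (φ y))) →
    (∀ {x} → x ∈ xs → T (P x) → Σ B (λ y → y ∈ ys × φ y ≡ x)) →
    sum (map (λ x → if P x then w x else 0) xs) ≡ sum (map (λ y → w (φ y)) ys)
  sum-filter-bijection {xs = xs} {ys} P w φ unique-xs unique-ys injective into onto =
    trans (sum-map-if P w xs) (trans (sum-↭ (Permutation.map⁺ w filter↭image)) (cong sum (sym (map-∘ ys))))
    where
    to : ∀ {z} → z ∈ filterᵇ P xs → z ∈ map φ ys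
    to m with ∈-filter⁻ _ {xs = xs} m
    ... | z∈xs , Pz with onto z∈xs Pz
    ... | y , y∈ys , refl = ∈-map⁺ φ y∈ys
    from : ∀ {z} → z ∈ map φ ys → z ∈ filterᵇ P xs
    from m with ∈-map⁻ φ m
    ... | y , y∈ys , refl = ∈-filter⁺ _ (proj₁ (into y∈ys)) (proj₂ (into y∈ys))
    filter↭image = ∼bag⇒↭ (unique∧set⇒bag (Unique.filter⁺ _ unique-xs) (Unique-map-injectiveOn φ injective unique-ys) (mk⇔ to from))

module Enumeration where

  open import Data.Nat using (ℕ; zero; suc; _≤_; z≤n; s≤s)
  open import Data.Nat.Properties using (suc-injective; ≤-pred)
  open import Data.Product using (_×_; _,_; proj₁; proj₂)
  open import Data.List using (List; []; _∷_; map; upTo; concatMap; length)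
  open import Data.List.Properties using (∷-injective)
  open import Data.List.Relation.Unary.All as All using (All; []; _∷_)
  import Data.List.Relation.Unary.All.Properties as All
  open import Data.List.Relation.Unary.Any using (here)
  import Data.List.Relation.Unary.AllPairs as AllPairs
  import Data.List.Relation.Unary.AllPairs.Properties as AllPairs
  open import Data.List.Relation.Unary.Unique.Propositional using (Unique)
  open import Data.List.Relation.Unary.AllPairs using ([]; _∷_)
  import Data.List.Relation.Unary.Unique.Propositional.Properties as Unique
  open import Data.List.Relation.Binary.Disjoint.Propositional using (Disjoint)
  open import Data.List.Membership.Propositional using (_∈_; find; lose)
  open import Data.List.Membership.Propositional.Properties
  open import Relation.Binary.PropositionalEquality
  open import Relation.Nullary using (¬_)

  Letter : ℕ → ℕ → Set
  Letter N a = 1 ≤ a × a ≤ N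

  ShortWord : ℕ → List ℕ → Set
  ShortWord N w = All (Letter N) w × length w ≤ N

  Unique-concatMap⁺ : ∀ {A B : Set} (f : A → List B) {xs} → Unique xs → (∀ x → Unique (f x)) →
    (∀ {x y} → ¬ x ≡ y → Disjoint (f x) (f y)) → Unique (concatMap f xs)
  Unique-concatMap⁺ f u uf dj =
    Unique.concat⁺ (All.map⁺ (All.tabulate (λ {x} _ → uf x))) (AllPairs.map⁺ (AllPairs.map dj u))

  Unique-map-∷ : ∀ {A : Set} (a : A) {ws} → Unique ws → Unique (map (a ∷_) ws)
  Unique-map-∷ a = Unique.map⁺ (λ e → proj₂ (∷-injective e))

  Disjoint-map-∷ : ∀ {A : Set} {a b : A} (ws vs : List (List A)) → ¬ a ≡ b → Disjoint (map (a ∷_) ws) (map (b ∷_) vs)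
  Disjoint-map-∷ ws vs a≢b (m₁ , m₂) with ∈-map⁻ _ m₁ | ∈-map⁻ _ m₂
  ... | _ , _ , refl | _ , _ , e = a≢b (proj₁ (∷-injective e))

  ∈-letters⁻ : ∀ {N a} → a ∈ map suc (upTo N) → Letter N a
  ∈-letters⁻ m with ∈-map⁻ suc m
  ... | i , i∈ , refl = s≤s z≤n , ∈-upTo⁻ i∈

  ∈-letters⁺ : ∀ {N a} → Letter N a → a ∈ map suc (upTo N)
  ∈-letters⁺ {N} {suc i} (_ , le) = ∈-map⁺ suc (∈-upTo⁺ le)

  wordsOfLength-unique : ∀ N l → Unique (wordsOfLength N l)
  wordsOfLength-unique N zero = [] ∷ []
  wordsOfLength-unique N (suc l) =
    Unique-concatMap⁺ (λ a → map (a ∷_) (wordsOfLength N l)) (Unique.map⁺ suc-injective (Unique.upTo⁺ N))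
      (λ a → Unique-map-∷ a (wordsOfLength-unique N l)) (Disjoint-map-∷ _ _)

  ∈-wordsOfLength⁻ : ∀ N l {w} → w ∈ wordsOfLength N l → All (Letter N) w × length w ≡ l
  ∈-wordsOfLength⁻ N zero (here refl) = [] , refl
  ∈-wordsOfLength⁻ N (suc l) m with find (∈-concatMap⁻ (λ a → map (a ∷_) (wordsOfLength N l)) {xs = map suc (upTo N)} m)
  ... | a , a∈ , m′ with ∈-map⁻ _ m′
  ... | w , w∈ , refl with ∈-wordsOfLength⁻ N l w∈
  ... | letters , len = ∈-letters⁻ a∈ ∷ letters , cong suc len

  ∈-wordsOfLength⁺ : ∀ N {w} → All (Letter N) w → w ∈ wordsOfLength N (length w)
  ∈-wordsOfLength⁺ N [] = here refl
  ∈-wordsOfLength⁺ N {a ∷ w} (la ∷ lw) =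
    ∈-concatMap⁺ (λ a → map (a ∷_) (wordsOfLength N (length w))) (lose (∈-letters⁺ la) (∈-map⁺ (a ∷_) (∈-wordsOfLength⁺ N lw)))

  wordsUpTo-unique : ∀ N → Unique (wordsUpTo N)
  wordsUpTo-unique N = Unique-concatMap⁺ (wordsOfLength N) (Unique.upTo⁺ (suc N)) (wordsOfLength-unique N)
    (λ l≢l′ (m₁ , m₂) → l≢l′ (trans (sym (proj₂ (∈-wordsOfLength⁻ N _ m₁))) (proj₂ (∈-wordsOfLength⁻ N _ m₂))))

  ∈-wordsUpTo⁻ : ∀ N {w} → w ∈ wordsUpTo N → ShortWord N w
  ∈-wordsUpTo⁻ N m with find (∈-concatMap⁻ (wordsOfLength N) {xs = upTo (suc N)} m)
  ... | l , l∈ , w∈ with ∈-wordsOfLength⁻ N l w∈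
  ... | letters , refl = letters , ≤-pred (∈-upTo⁻ l∈)

  ∈-wordsUpTo⁺ : ∀ N {w} → ShortWord N w → w ∈ wordsUpTo N
  ∈-wordsUpTo⁺ N (letters , short) = ∈-concatMap⁺ (wordsOfLength N) (lose (∈-upTo⁺ (s≤s short)) (∈-wordsOfLength⁺ N letters))

  blockLists-unique : ∀ N K → Unique (blockLists N K)
  blockLists-unique N zero = [] ∷ []
  blockLists-unique N (suc K) =
    Unique-concatMap⁺ (λ w → map (w ∷_) (blockLists N K)) (wordsUpTo-unique N)
      (λ w → Unique-map-∷ w (blockLists-unique N K)) (Disjoint-map-∷ _ _)

  ∈-blockLists⁻ : ∀ N K {δ} → δ ∈ blockLists N K → length δ ≡ K × All (ShortWord N) δ
  ∈-blockLists⁻ N zero (here refl) = refl , []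
  ∈-blockLists⁻ N (suc K) m with find (∈-concatMap⁻ (λ w → map (w ∷_) (blockLists N K)) {xs = wordsUpTo N} m)
  ... | w , w∈ , m′ with ∈-map⁻ _ m′
  ... | δ , δ∈ , refl with ∈-blockLists⁻ N K δ∈
  ... | len , short = cong suc len , ∈-wordsUpTo⁻ N w∈ ∷ short

  ∈-blockLists⁺ : ∀ N {δ} → All (ShortWord N) δ → δ ∈ blockLists N (length δ)
  ∈-blockLists⁺ N [] = here refl
  ∈-blockLists⁺ N {w ∷ δ} (sw ∷ sδ) =
    ∈-concatMap⁺ (λ w → map (w ∷_) (blockLists N (length δ))) (lose (∈-wordsUpTo⁺ N sw) (∈-map⁺ (w ∷_) (∈-blockLists⁺ N sδ)))

module Words where

  open import Data.Nat using (ℕ; zero; suc; _+_; _∸_; _≤_; _<_; z≤n; s≤s; _≡ᵇ_; _⊓_)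
  open import Data.Nat.Properties
  open import Data.Bool using (Bool; true; false; T; if_then_else_)
  open import Data.Bool.Properties using (T-≡)
  open import Data.Empty using (⊥-elim)
  open import Data.Sum using (_⊎_; inj₁; inj₂)
  open import Data.Product using (_×_; _,_; proj₁; proj₂)
  open import Data.List using (List; []; _∷_; _++_; length; filter; foldr)
  open import Data.List.Properties using (filter-all; filter-reject)
  open import Data.List.Relation.Unary.All as All using (All; []; _∷_)
  open import Data.List.Relation.Unary.Any using (here; there)
  open import Data.List.Membership.Propositional using (_∈_)
  open import Function.Bundles using (Equivalence)
  open import Relation.Binary.PropositionalEquality
  open import Relation.Nullary using (¬_; yes; no)
  open import Relation.Unary using (Pred; Decidable)
  open import Level using (0ℓ)

  ≡ᵇ-refl : ∀ x → (x ≡ᵇ x) ≡ true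
  ≡ᵇ-refl x = Equivalence.to T-≡ (≡⇒≡ᵇ x x refl)

  ≡ᵇ≡true⇒≡ : ∀ {x a} → (x ≡ᵇ a) ≡ true → x ≡ a
  ≡ᵇ≡true⇒≡ {x} {a} e = ≡ᵇ⇒≡ x a (Equivalence.from T-≡ e)

  ≡ᵇ≡false⇒≢ : ∀ {x a} → (x ≡ᵇ a) ≡ false → ¬ x ≡ a
  ≡ᵇ≡false⇒≢ {x} e refl with () ← trans (sym (≡ᵇ-refl x)) e

  ≢⇒≡ᵇ≡false : ∀ {x a} → ¬ x ≡ a → (x ≡ᵇ a) ≡ false
  ≢⇒≡ᵇ≡false {x} {a} x≢a with x ≡ᵇ a in e
  ... | true = ⊥-elim (x≢a (≡ᵇ≡true⇒≡ e))
  ... | false = refl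

  NonEmpty : List ℕ → Set
  NonEmpty w = T (nonempty w)

  indicator : ℕ → ℕ → ℕ
  indicator i a = if i ≡ᵇ a then 1 else 0

  count-∷ : ∀ i a l → count i (a ∷ l) ≡ indicator i a + count i l
  count-∷ i a l with i ≡ᵇ a
  ... | true = refl
  ... | false = refl

  count-++ : ∀ i u v → count i (u ++ v) ≡ count i u + count i v
  count-++ i [] v = refl
  count-++ i (a ∷ u) v rewrite count-∷ i a (u ++ v) | count-∷ i a u | count-++ i u v =
    sym (+-assoc (indicator i a) (count i u) (count i v))

  count-∷-self : ∀ x l → count x (x ∷ l) ≡ suc (count x l)
  count-∷-self x l rewrite ≡ᵇ-refl x = refl

  count-∷≡0⁻ : ∀ x a w → count x (a ∷ w) ≡ 0 → (x ≡ᵇ a) ≡ false × count x w ≡ 0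
  count-∷≡0⁻ x a w e with x ≡ᵇ a
  ... | false = refl , e

  count-fresh : ∀ x w → All (λ a → ¬ a ≡ x) w → count x w ≡ 0
  count-fresh x [] [] = refl
  count-fresh x (a ∷ w) (a≢x ∷ rest) rewrite ≢⇒≡ᵇ≡false {x} {a} (λ e → a≢x (sym e)) = count-fresh x w rest

  insertAt : ℕ → ℕ → List ℕ → List ℕ
  insertAt zero x w = x ∷ w
  insertAt (suc p) x [] = x ∷ []
  insertAt (suc p) x (a ∷ w) = a ∷ insertAt p x w

  count-insertAt : ∀ i p x w → count i (insertAt p x w) ≡ count i (x ∷ w)
  count-insertAt i zero x w = refl
  count-insertAt i (suc p) x [] = refl
  count-insertAt i (suc p) x (a ∷ w)
    rewrite count-∷ i a (insertAt p x w) | count-insertAt i p x w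
          | count-∷ i x w | count-∷ i x (a ∷ w) | count-∷ i a w =
    trans (sym (+-assoc (indicator i a) (indicator i x) _))
          (trans (cong (_+ count i w) (+-comm (indicator i a) (indicator i x))) (+-assoc (indicator i x) (indicator i a) (count i w)))

  length-insertAt : ∀ p x w → length (insertAt p x w) ≡ suc (length w)
  length-insertAt zero x w = refl
  length-insertAt (suc p) x [] = refl
  length-insertAt (suc p) x (a ∷ w) = cong suc (length-insertAt p x w)

  insertAt-nonEmpty : ∀ p x w → NonEmpty (insertAt p x w)
  insertAt-nonEmpty zero x w = _
  insertAt-nonEmpty (suc p) x [] = _
  insertAt-nonEmpty (suc p) x (a ∷ w) = _

  insertAt-++ˡ : ∀ p x w v → p ≤ length w → insertAt p x (w ++ v) ≡ insertAt p x w ++ v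
  insertAt-++ˡ zero x w v _ = refl
  insertAt-++ˡ (suc p) x (a ∷ w) v (s≤s le) = cong (a ∷_) (insertAt-++ˡ p x w v le)

  insertAt-++ʳ : ∀ p x w v → insertAt (length w + p) x (w ++ v) ≡ w ++ insertAt p x v
  insertAt-++ʳ p x [] v = refl
  insertAt-++ʳ p x (a ∷ w) v = cong (a ∷_) (insertAt-++ʳ p x w v)

  All-insertAt : ∀ {Q : ℕ → Set} p x w → All Q w → Q x → All Q (insertAt p x w)
  All-insertAt zero x w qw qx = qx ∷ qw
  All-insertAt (suc p) x [] qw qx = qx ∷ []
  All-insertAt (suc p) x (a ∷ w) (qa ∷ qw) qx = qa ∷ All-insertAt p x w qw qx

  ∈-insertAt : ∀ {e} p x w → e ∈ w → e ∈ insertAt p x w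
  ∈-insertAt zero x w m = there m
  ∈-insertAt (suc p) x (a ∷ w) (here e) = here e
  ∈-insertAt (suc p) x (a ∷ w) (there m) = there (∈-insertAt p x w m)

  filter-insertAt : ∀ {P : Pred ℕ 0ℓ} (P? : Decidable P) p x w → ¬ P x → filter P? (insertAt p x w) ≡ filter P? w
  filter-insertAt P? zero x w ¬Px = filter-reject P? ¬Px
  filter-insertAt P? (suc p) x [] ¬Px = filter-reject P? ¬Px
  filter-insertAt P? (suc p) x (a ∷ w) ¬Px with P? a
  ... | yes _ = cong (a ∷_) (filter-insertAt P? p x w ¬Px)
  ... | no _ = filter-insertAt P? p x w ¬Px

  inv-insertAt-max : ∀ p x w → All (_< x) w → p ≤ length w → inv (insertAt p x w) ≡ inv w + (length w ∸ p)
  inv-insertAt-max zero x w w<x _ =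
    trans (cong (λ z → length z + inv w) (filter-all (_<? x) w<x)) (+-comm (length w) (inv w))
  inv-insertAt-max (suc p) x (a ∷ w) (a<x ∷ w<x) (s≤s le) =
    trans (cong₂ _+_ (cong length (filter-insertAt (_<? a) p x w (λ x<a → <-asym a<x x<a))) (inv-insertAt-max p x w w<x le))
          (sym (+-assoc (length (filter (_<? a) w)) (inv w) _))

  remove : ℕ → List ℕ → List ℕ
  remove x [] = []
  remove x (a ∷ w) = if x ≡ᵇ a then remove x w else a ∷ remove x w

  remove-fresh : ∀ x w → count x w ≡ 0 → remove x w ≡ w
  remove-fresh x [] _ = refl
  remove-fresh x (a ∷ w) e with x ≡ᵇ a
  ... | false = cong (a ∷_) (remove-fresh x w e)

  remove-insertAt : ∀ p x w → count x w ≡ 0 → remove x (insertAt p x w) ≡ w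
  remove-insertAt zero x w e rewrite ≡ᵇ-refl x = remove-fresh x w e
  remove-insertAt (suc p) x [] e rewrite ≡ᵇ-refl x = refl
  remove-insertAt (suc p) x (a ∷ w) e with count-∷≡0⁻ x a w e
  ... | x≢a , e′ rewrite x≢a = cong (a ∷_) (remove-insertAt p x w e′)

  All-remove : ∀ {P : ℕ → Set} x w → All P w → All (λ a → P a × ¬ a ≡ x) (remove x w)
  All-remove x [] [] = []
  All-remove x (a ∷ w) (pa ∷ pw) with x ≡ᵇ a in e
  ... | true = All-remove x w pw
  ... | false = (pa , (λ a≡x → ≡ᵇ≡false⇒≢ e (sym a≡x))) ∷ All-remove x w pw

  remove-nonEmpty : ∀ x w → count x w ≤ 1 → ¬ w ≡ x ∷ [] → NonEmpty w → NonEmpty (remove x w)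
  remove-nonEmpty x (a ∷ w) once w≢[x] _ with x ≡ᵇ a in e
  ... | false = _
  ... | true with w
  ...   | [] = ⊥-elim (w≢[x] (cong (_∷ []) (sym (≡ᵇ≡true⇒≡ e))))
  ...   | b ∷ w′ with x ≡ᵇ b
  ...     | false = _
  ...     | true with s≤s () ← once

  positionOf : ℕ → List ℕ → ℕ
  positionOf x [] = 0
  positionOf x (a ∷ w) = if x ≡ᵇ a then 0 else suc (positionOf x w)

  positionOf-insertAt : ∀ p x w → count x w ≡ 0 → p ≤ length w → positionOf x (insertAt p x w) ≡ p
  positionOf-insertAt zero x w e _ rewrite ≡ᵇ-refl x = refl
  positionOf-insertAt (suc p) x (a ∷ w) e (s≤s le) with count-∷≡0⁻ x a w e
  ... | x≢a , e′ rewrite x≢a = cong suc (positionOf-insertAt p x w e′ le)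

  insertAt-positionOf : ∀ x w → count x w ≡ 1 →
    positionOf x w ≤ length (remove x w) × insertAt (positionOf x w) x (remove x w) ≡ w
  insertAt-positionOf x (a ∷ w) once with x ≡ᵇ a in e
  ... | true = z≤n , cong₂ _∷_ (≡ᵇ≡true⇒≡ e) (remove-fresh x w (suc-injective once))
  ... | false with insertAt-positionOf x w once
  ...   | le , w≡ = s≤s le , cong (a ∷_) w≡

  IsMin : ℕ → List ℕ → Set
  IsMin m l = m ∈ l × All (m ≤_) l

  IsMin-unique : ∀ {m₁ m₂ l} → IsMin m₁ l → IsMin m₂ l → m₁ ≡ m₂
  IsMin-unique (m₁∈ , m₁≤) (m₂∈ , m₂≤) = ≤-antisym (All.lookup m₁≤ m₂∈) (All.lookup m₂≤ m₁∈)

  minWord-isMin : ∀ a w → IsMin (minWord (a ∷ w)) (a ∷ w)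
  minWord-isMin a [] = here refl , (≤-refl ∷ [])
  minWord-isMin a (b ∷ w) with minWord-isMin a w
  ... | m∈ , (m≤a ∷ m≤w) =
    ∈-⊓ (⊓-sel b m) , (≤-trans (m⊓n≤n b m) m≤a ∷ m⊓n≤m b m ∷ All.map (≤-trans (m⊓n≤n b m)) m≤w)
    where
    m = foldr _⊓_ a w
    ∈-⊓ : (b ⊓ m ≡ b) ⊎ (b ⊓ m ≡ m) → b ⊓ m ∈ (a ∷ b ∷ w)
    ∈-⊓ (inj₁ e) = subst (_∈ (a ∷ b ∷ w)) (sym e) (there (here refl))
    ∈-⊓ (inj₂ e) = subst (_∈ (a ∷ b ∷ w)) (sym e) (skip m∈)
      where
      skip : ∀ {z} → z ∈ (a ∷ w) → z ∈ (a ∷ b ∷ w)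
      skip (here z≡a) = here z≡a
      skip (there z∈w) = there (there z∈w)

  minWord≤head : ∀ a w → minWord (a ∷ w) ≤ a
  minWord≤head a w with minWord-isMin a w
  ... | _ , (m≤a ∷ _) = m≤a

  minWord-insertAt : ∀ p x a w → minWord (a ∷ w) ≤ x → minWord (insertAt p x (a ∷ w)) ≡ minWord (a ∷ w)
  minWord-insertAt p x a w m≤x = IsMin-unique (isMin p)
    (∈-insertAt p x (a ∷ w) (proj₁ (minWord-isMin a w)) , All-insertAt p x (a ∷ w) (proj₂ (minWord-isMin a w)) m≤x)
    where
    isMin : ∀ p → IsMin (minWord (insertAt p x (a ∷ w))) (insertAt p x (a ∷ w))
    isMin zero = minWord-isMin x (a ∷ w)
    isMin (suc p) = minWord-isMin a (insertAt p x w)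

module Blocks where

  open Words
  open import Data.Nat using (ℕ; zero; suc; _+_; _∸_; _≤_; s≤s; _≤ᵇ_; _≡ᵇ_; _≤?_)
  open import Data.Nat.Properties
  open import Data.Bool using (true; false; if_then_else_)
  open import Data.Bool.Properties using (T-≡)
  open import Data.Empty using (⊥-elim)
  open import Data.Product using (_×_; _,_)
  open import Data.List using (List; []; _∷_; map; _++_; length; concat; intercalate)
  open import Data.List.Properties using (length-++; ++-identityʳ)
  open import Data.List.Relation.Unary.All using (All; []; _∷_)
  open import Function.Bundles using (Equivalence)
  open import Relation.Binary.PropositionalEquality
  open import Relation.Nullary using (¬_; yes; no)
  open ≡-Reasoning

  joined : List (List ℕ) → List ℕ
  joined δ = intercalate (0 ∷ []) δ

  insertBlocks : ℕ → ℕ → List (List ℕ) → List (List ℕ)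
  insertBlocks p x [] = []
  insertBlocks p x (b ∷ bs) = if p ≤ᵇ length b then insertAt p x b ∷ bs else b ∷ insertBlocks (p ∸ suc (length b)) x bs

  removeBlocks : ℕ → List (List ℕ) → List (List ℕ)
  removeBlocks x δ = map (remove x) δ

  positionInBlocks : ℕ → List (List ℕ) → ℕ
  positionInBlocks x [] = 0
  positionInBlocks x (b ∷ bs) = if count x b ≡ᵇ 0 then length b + suc (positionInBlocks x bs) else positionOf x b

  data Position : ℕ → List (List ℕ) → Set where
    inHead : ∀ {p b bs} → p ≤ length b → Position p (b ∷ bs)
    inTail : ∀ {p b bs} → Position p bs → Position (length b + suc p) (b ∷ bs)

  insertBlocks-head : ∀ p x b bs → p ≤ length b → insertBlocks p x (b ∷ bs) ≡ insertAt p x b ∷ bs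
  insertBlocks-head p x b bs le rewrite Equivalence.to T-≡ (≤⇒≤ᵇ le) = refl

  ≰⇒≤ᵇ≡false : ∀ {m n} → ¬ m ≤ n → (m ≤ᵇ n) ≡ false
  ≰⇒≤ᵇ≡false {m} {n} m≰n with m ≤ᵇ n in e
  ... | true = ⊥-elim (m≰n (≤ᵇ⇒≤ m n (Equivalence.from T-≡ e)))
  ... | false = refl

  insertBlocks-tail : ∀ p x b bs → insertBlocks (length b + suc p) x (b ∷ bs) ≡ b ∷ insertBlocks p x bs
  insertBlocks-tail p x b bs rewrite ≰⇒≤ᵇ≡false (m+1+n≰m (length b) {p}) | +-suc (length b) p | m+n∸m≡n (length b) p = refl

  joined-∷ : ∀ b l → ¬ l ≡ [] → joined (b ∷ l) ≡ b ++ 0 ∷ joined l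
  joined-∷ b [] l≢[] = ⊥-elim (l≢[] refl)
  joined-∷ b (c ∷ cs) _ = refl

  length-joined : ∀ b bs → length (joined (b ∷ bs)) ≡ length (concat (b ∷ bs)) + length bs
  length-joined b [] = trans (cong length (sym (++-identityʳ b))) (sym (+-identityʳ _))
  length-joined b (c ∷ cs)
    rewrite length-++ b {0 ∷ joined (c ∷ cs)} | length-joined c cs | length-++ b {concat (c ∷ cs)} | length-++ c {concat cs} =
    trans (+-suc (length b) _)
      (trans (cong suc (sym (+-assoc (length b) _ (length cs))))
             (sym (+-suc (length b + (length c + length (concat cs))) (length cs))))

  ≤length-joined⇒Position : ∀ b bs p → p ≤ length (joined (b ∷ bs)) → Position p (b ∷ bs)
  ≤length-joined⇒Position b bs p le with p ≤? length b
  ... | yes p≤b = inHead p≤b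
  ≤length-joined⇒Position b [] p le | no p≰b = ⊥-elim (p≰b le)
  ≤length-joined⇒Position b (c ∷ cs) p le | no p≰b =
    subst (λ z → Position z (b ∷ c ∷ cs)) p≡ (inTail (≤length-joined⇒Position c cs p′ le′))
    where
    p′ = p ∸ suc (length b)
    p≡ : length b + suc p′ ≡ p
    p≡ = trans (+-suc (length b) p′) (m+[n∸m]≡n (≰⇒> p≰b))
    le′ : p′ ≤ length (joined (c ∷ cs))
    le′ = subst (p′ ≤_) (trans (cong (_∸ suc (length b)) (length-++ b {0 ∷ joined (c ∷ cs)}))
                               (trans (cong (_∸ suc (length b)) (+-suc (length b) _)) (m+n∸m≡n (length b) _)))
                (∸-monoˡ-≤ (suc (length b)) le)

  module _ (x : ℕ) where

    Position⇒nonEmpty : ∀ {p δ} → Position p δ → ¬ δ ≡ []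
    Position⇒nonEmpty (inHead _) ()
    Position⇒nonEmpty (inTail _) ()

    length-insertBlocks : ∀ {p δ} → Position p δ → length (insertBlocks p x δ) ≡ length δ
    length-insertBlocks {p} {b ∷ bs} (inHead le) rewrite insertBlocks-head p x b bs le = refl
    length-insertBlocks {_} {b ∷ bs} (inTail {p} pos) rewrite insertBlocks-tail p x b bs = cong suc (length-insertBlocks pos)

    insertBlocks-nonEmpty : ∀ {p δ} → Position p δ → ¬ insertBlocks p x δ ≡ []
    insertBlocks-nonEmpty pos e = Position⇒nonEmpty pos (length≡0 (trans (sym (length-insertBlocks pos)) (cong length e)))
      where
      length≡0 : ∀ {l : List (List ℕ)} → length l ≡ 0 → l ≡ []
      length≡0 {[]} _ = refl

    count-insertBlocks : ∀ {p δ} → Position p δ → ∀ i → count i (concat (insertBlocks p x δ)) ≡ count i (x ∷ concat δ)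
    count-insertBlocks {p} {b ∷ bs} (inHead le) i rewrite insertBlocks-head p x b bs le = begin
      count i (insertAt p x b ++ concat bs)          ≡⟨ count-++ i (insertAt p x b) (concat bs) ⟩
      count i (insertAt p x b) + count i (concat bs) ≡⟨ cong (_+ count i (concat bs)) (count-insertAt i p x b) ⟩
      count i (x ∷ b) + count i (concat bs)          ≡⟨ count-++ i (x ∷ b) (concat bs) ⟨
      count i (x ∷ b ++ concat bs)                   ∎
    count-insertBlocks {_} {b ∷ bs} (inTail {p} pos) i rewrite insertBlocks-tail p x b bs = begin
      count i (b ++ concat (insertBlocks p x bs))          ≡⟨ count-++ i b _ ⟩
      count i b + count i (concat (insertBlocks p x bs))
        ≡⟨ cong (count i b +_) (trans (count-insertBlocks pos i) (count-∷ i x (concat bs))) ⟩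
      count i b + (indicator i x + count i (concat bs))
        ≡⟨ solve 3 (λ b e c → b :+ (e :+ c) := e :+ (b :+ c)) refl (count i b) (indicator i x) (count i (concat bs)) ⟩
      indicator i x + (count i b + count i (concat bs))    ≡⟨ cong (indicator i x +_) (count-++ i b (concat bs)) ⟨
      indicator i x + count i (b ++ concat bs)             ≡⟨ count-∷ i x (b ++ concat bs) ⟨
      count i (x ∷ b ++ concat bs)                         ∎
      where
      open import Data.Nat.Solver using (module +-*-Solver)
      open +-*-Solver using (solve; _:=_; _:+_)

    size-insertBlocks : ∀ {p δ} → Position p δ → length (concat (insertBlocks p x δ)) ≡ suc (length (concat δ))
    size-insertBlocks {p} {b ∷ bs} (inHead le)
      rewrite insertBlocks-head p x b bs le | length-++ (insertAt p x b) {concat bs} | length-insertAt p x b | length-++ b {concat bs} = refl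
    size-insertBlocks {_} {b ∷ bs} (inTail {p} pos)
      rewrite insertBlocks-tail p x b bs | length-++ b {concat (insertBlocks p x bs)} | size-insertBlocks pos | length-++ b {concat bs} =
      +-suc (length b) _

    All-insertBlocks : ∀ {Q : List ℕ → Set} {p δ} → Position p δ → All Q δ → (∀ p b → Q b → Q (insertAt p x b)) →
      All Q (insertBlocks p x δ)
    All-insertBlocks {Q} {p} {b ∷ bs} (inHead le) (qb ∷ qs) h rewrite insertBlocks-head p x b bs le = h p b qb ∷ qs
    All-insertBlocks {Q} {_} {b ∷ bs} (inTail {p} pos) (qb ∷ qs) h rewrite insertBlocks-tail p x b bs = qb ∷ All-insertBlocks pos qs h

    map-insertBlocks : ∀ {A : Set} (f : List ℕ → A) (G : List ℕ → Set) {p δ} → Position p δ → All G δ →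
      (∀ p b → p ≤ length b → G b → f (insertAt p x b) ≡ f b) → map f (insertBlocks p x δ) ≡ map f δ
    map-insertBlocks f G {p} {b ∷ bs} (inHead le) (gb ∷ gs) h rewrite insertBlocks-head p x b bs le = cong (_∷ map f bs) (h p b le gb)
    map-insertBlocks f G {_} {b ∷ bs} (inTail {p} pos) (gb ∷ gs) h rewrite insertBlocks-tail p x b bs =
      cong (f b ∷_) (map-insertBlocks f G pos gs h)

    joined-insertBlocks : ∀ {p δ} → Position p δ → joined (insertBlocks p x δ) ≡ insertAt p x (joined δ)
    joined-insertBlocks {p} {b ∷ []} (inHead le) rewrite insertBlocks-head p x b [] le = refl
    joined-insertBlocks {p} {b ∷ c ∷ cs} (inHead le) rewrite insertBlocks-head p x b (c ∷ cs) le =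
      sym (insertAt-++ˡ p x b (0 ∷ joined (c ∷ cs)) le)
    joined-insertBlocks {_} {b ∷ bs} (inTail {p} pos)
      rewrite insertBlocks-tail p x b bs | joined-∷ b (insertBlocks p x bs) (insertBlocks-nonEmpty pos)
            | joined-∷ b bs (Position⇒nonEmpty pos) | joined-insertBlocks pos =
      sym (insertAt-++ʳ (suc p) x b (0 ∷ joined bs))

    Position⇒≤length-joined : ∀ {p δ} → Position p δ → p ≤ length (joined δ)
    Position⇒≤length-joined {p} {b ∷ []} (inHead le) = le
    Position⇒≤length-joined {p} {b ∷ c ∷ cs} (inHead le) rewrite length-++ b {0 ∷ joined (c ∷ cs)} = ≤-trans le (m≤m+n (length b) _)
    Position⇒≤length-joined {_} {b ∷ bs} (inTail {p} pos)
      rewrite joined-∷ b bs (Position⇒nonEmpty pos) | length-++ b {0 ∷ joined bs} =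
      +-monoʳ-≤ (length b) (s≤s (Position⇒≤length-joined pos))

    removeBlocks-fresh : ∀ δ → All (λ b → count x b ≡ 0) δ → removeBlocks x δ ≡ δ
    removeBlocks-fresh [] [] = refl
    removeBlocks-fresh (b ∷ δ) (e ∷ es) = cong₂ _∷_ (remove-fresh x b e) (removeBlocks-fresh δ es)

    count-concat≡0⁻ : ∀ δ → count x (concat δ) ≡ 0 → All (λ b → count x b ≡ 0) δ
    count-concat≡0⁻ [] _ = []
    count-concat≡0⁻ (b ∷ δ) e rewrite count-++ x b (concat δ) =
      m+n≡0⇒m≡0 (count x b) e ∷ count-concat≡0⁻ δ (m+n≡0⇒n≡0 (count x b) e)

    removeBlocks-insertBlocks : ∀ {p δ} → Position p δ → All (λ b → count x b ≡ 0) δ → removeBlocks x (insertBlocks p x δ) ≡ δ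
    removeBlocks-insertBlocks {p} {b ∷ bs} (inHead le) (e ∷ es) rewrite insertBlocks-head p x b bs le =
      cong₂ _∷_ (remove-insertAt p x b e) (removeBlocks-fresh bs es)
    removeBlocks-insertBlocks {_} {b ∷ bs} (inTail {p} pos) (e ∷ es) rewrite insertBlocks-tail p x b bs =
      cong₂ _∷_ (remove-fresh x b e) (removeBlocks-insertBlocks pos es)

    positionInBlocks-insertBlocks : ∀ {p δ} → Position p δ → All (λ b → count x b ≡ 0) δ →
      positionInBlocks x (insertBlocks p x δ) ≡ p
    positionInBlocks-insertBlocks {p} {b ∷ bs} (inHead le) (e ∷ es)
      rewrite insertBlocks-head p x b bs le | count-insertAt x p x b | ≡ᵇ-refl x = positionOf-insertAt p x b e le
    positionInBlocks-insertBlocks {_} {b ∷ bs} (inTail {p} pos) (e ∷ es)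
      rewrite insertBlocks-tail p x b bs | e = cong (λ z → length b + suc z) (positionInBlocks-insertBlocks pos es)

    insertBlocks-positionInBlocks : ∀ δ → count x (concat δ) ≡ 1 →
      Position (positionInBlocks x δ) (removeBlocks x δ) × insertBlocks (positionInBlocks x δ) x (removeBlocks x δ) ≡ δ
    insertBlocks-positionInBlocks (b ∷ bs) once with count x b in eb | count-++ x b (concat bs)
    ... | zero | split with insertBlocks-positionInBlocks bs (trans (sym split) once)
    ...   | pos , δ≡ rewrite remove-fresh x b eb =
      inTail pos , trans (insertBlocks-tail (positionInBlocks x bs) x b (removeBlocks x bs)) (cong (b ∷_) δ≡)
    insertBlocks-positionInBlocks (b ∷ bs) once | suc c | split
      with insertAt-positionOf x b (trans eb (cong suc c≡0)) | removeBlocks-fresh bs (count-concat≡0⁻ bs rest≡0)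
      where
      c≡0 : c ≡ 0
      c≡0 = m+n≡0⇒m≡0 c (suc-injective (trans (sym split) once))
      rest≡0 : count x (concat bs) ≡ 0
      rest≡0 = m+n≡0⇒n≡0 c (suc-injective (trans (sym split) once))
    ... | le , b≡ | bs≡ rewrite bs≡ = inHead le , trans (insertBlocks-head (positionOf x b) x (remove x b) bs le) (cong (_∷ bs) b≡)

module Distributions (r : ℕ) where

  open Enumeration
  open Words
  open Blocks
  open import Data.Nat using (suc; _≤_; _<_; z≤n; s≤s; _≡ᵇ_; _<ᵇ_)
  open import Data.Nat.Properties
  open import Data.Bool using (Bool; true; T; _∧_)
  open import Data.Bool.Properties using (T-∧)
  open import Data.Sum using (inj₁; inj₂)
  open import Data.Product using (_×_; _,_; proj₁; proj₂)
  open import Data.List using (List; []; _∷_; map; length; filter; concat; upTo)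
  open import Data.Bool.ListAction using (all)
  open import Data.List.Properties using (length-++)
  open import Data.List.Relation.Unary.All as All using (All; []; _∷_)
  import Data.List.Relation.Unary.All.Properties as All
  open import Data.List.Membership.Propositional using (_∈_)
  open import Function.Bundles using (Equivalence)
  open import Relation.Binary.PropositionalEquality

  EachOnce : ℕ → List ℕ → Set
  EachOnce N l = ∀ i → 1 ≤ i → i ≤ N → count i l ≡ 1

  EachOnce-∷ : ∀ N l → EachOnce N l → count (suc N) l ≡ 0 → EachOnce (suc N) (suc N ∷ l)
  EachOnce-∷ N l once fresh i 1≤i i≤N+1 with m≤n⇒m<n∨m≡n i≤N+1
  ... | inj₁ i<N+1 rewrite ≢⇒≡ᵇ≡false {i} {suc N} (<⇒≢ i<N+1) = once i 1≤i (≤-pred i<N+1)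
  ... | inj₂ refl rewrite ≡ᵇ-refl (suc N) = cong suc fresh

  EachOnce-∷⁻ : ∀ N l → EachOnce (suc N) (suc N ∷ l) → EachOnce N l
  EachOnce-∷⁻ N l once i 1≤i i≤N with once i 1≤i (m≤n⇒m≤1+n i≤N)
  ... | h rewrite ≢⇒≡ᵇ≡false {i} {suc N} (<⇒≢ (s≤s i≤N)) = h

  separatorCount : List ℕ → ℕ
  separatorCount b = length (filter (_≤? r) b)

  record IsLahDistribution (N K : ℕ) (δ : List (List ℕ)) : Set where
    field
      blockCount : length δ ≡ K
      letters    : All (All (Letter N)) δ
      nonEmpty   : All NonEmpty δ
      once       : EachOnce N (concat δ)
      size       : length (concat δ) ≡ N
      decreasing : T (decreasingMins δ)
      separating : All (λ b → separatorCount b ≤ 1) δ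

  length≤length-concat : ∀ (δ : List (List ℕ)) → All (λ b → length b ≤ length (concat δ)) δ
  length≤length-concat [] = []
  length≤length-concat (b ∷ δ) = subst (length b ≤_) (sym (length-++ b)) (m≤m+n (length b) _)
    ∷ All.map (λ h → ≤-trans h (subst (length (concat δ) ≤_) (sym (length-++ b)) (m≤n+m _ (length b)))) (length≤length-concat δ)

  count≤count-concat : ∀ i δ → All (λ b → count i b ≤ count i (concat δ)) δ
  count≤count-concat i [] = []
  count≤count-concat i (b ∷ δ) = subst (count i b ≤_) (sym (count-++ i b (concat δ))) (m≤m+n (count i b) _)
    ∷ All.map (λ h → ≤-trans h (subst (count i (concat δ) ≤_) (sym (count-++ i b (concat δ))) (m≤n+m _ (count i b))))
              (count≤count-concat i δ)

  blocks≤size : ∀ δ → All NonEmpty δ → length δ ≤ length (concat δ)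
  blocks≤size [] [] = z≤n
  blocks≤size ((a ∷ w) ∷ δ) (_ ∷ ne) =
    s≤s (≤-trans (blocks≤size δ ne) (subst (length (concat δ) ≤_) (sym (length-++ w)) (m≤n+m _ (length w))))

  size≤blocks : ∀ (δ : List (List ℕ)) → All (λ b → length b ≤ 1) δ → length (concat δ) ≤ length δ
  size≤blocks [] [] = z≤n
  size≤blocks (b ∷ δ) (h ∷ hs) = subst (_≤ suc (length δ)) (sym (length-++ b)) (+-mono-≤ h (size≤blocks δ hs))

  strictlyDecreasing : List ℕ → Bool
  strictlyDecreasing [] = true
  strictlyDecreasing (a ∷ []) = true
  strictlyDecreasing (a ∷ b ∷ l) = (b <ᵇ a) ∧ strictlyDecreasing (b ∷ l)

  decreasingMins≡ : ∀ δ → decreasingMins δ ≡ strictlyDecreasing (map minWord δ)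
  decreasingMins≡ [] = refl
  decreasingMins≡ (b ∷ []) = refl
  decreasingMins≡ (b ∷ c ∷ bs) = cong ((minWord c <ᵇ minWord b) ∧_) (decreasingMins≡ (c ∷ bs))

  decreasingMins-cong : ∀ {δ δ′} → map minWord δ ≡ map minWord δ′ → T (decreasingMins δ) → T (decreasingMins δ′)
  decreasingMins-cong {δ} {δ′} mins≡ =
    subst T (trans (decreasingMins≡ δ) (trans (cong strictlyDecreasing mins≡) (sym (decreasingMins≡ δ′))))

  decreasingMins-tail : ∀ b bs → T (decreasingMins (b ∷ bs)) → T (decreasingMins bs)
  decreasingMins-tail b [] _ = _
  decreasingMins-tail b (c ∷ bs) d = proj₂ (Equivalence.to (T-∧ {minWord c <ᵇ minWord b}) d)

  decreasingMins-head : ∀ b bs → T (decreasingMins (b ∷ bs)) → All (λ c → minWord c < minWord b) bs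
  decreasingMins-head b [] _ = []
  decreasingMins-head b (c ∷ bs) d with Equivalence.to (T-∧ {minWord c <ᵇ minWord b}) d
  ... | c<b , rest = <ᵇ⇒< _ _ c<b ∷ All.map (λ h → <-trans h (<ᵇ⇒< _ _ c<b)) (decreasingMins-head c bs rest)

  minWord≤ : ∀ N b → All (Letter N) b → NonEmpty b → minWord b ≤ N
  minWord≤ N (a ∷ w) ((_ , a≤N) ∷ _) _ = ≤-trans (minWord≤head a w) a≤N

  ∧-join : ∀ {a b} → T a → T b → T (a ∧ b)
  ∧-join ta tb = Equivalence.from T-∧ (ta , tb)

  accepts : ℕ → List (List ℕ) → Bool
  accepts N δ = isLah N δ ∧ separated r δ

  module _ {N K δ} (d : IsLahDistribution N K δ) where
    open IsLahDistribution d

    IsLahDistribution⇒accepts : T (accepts N δ)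
    IsLahDistribution⇒accepts =
      ∧-join (∧-join (All.all⁻ nonempty nonEmpty) (∧-join (All.all⁻ _ eachOnce) (∧-join (≡⇒≡ᵇ _ _ size) decreasing)))
             (All.all⁻ _ (All.map ≤⇒≤ᵇ separating))
      where
      eachOnce : All (λ i → T (count i (concat δ) ≡ᵇ 1)) (map suc (upTo N))
      eachOnce = All.tabulate (λ i∈ → let (1≤i , i≤N) = ∈-letters⁻ i∈ in ≡⇒≡ᵇ _ _ (once _ 1≤i i≤N))

    IsLahDistribution⇒∈-blockLists : δ ∈ blockLists N K
    IsLahDistribution⇒∈-blockLists = subst (λ z → δ ∈ blockLists N z) blockCount (∈-blockLists⁺ N shortWords)
      where
      shortWords : All (ShortWord N) δ
      shortWords = All.zipWith (λ h → h) (letters , subst (λ z → All (λ b → length b ≤ z) δ) size (length≤length-concat δ))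

  ∧-split : ∀ a {b} → T (a ∧ b) → T a × T b
  ∧-split a = Equivalence.to (T-∧ {a})

  accepts⇒IsLahDistribution : ∀ {N K δ} → δ ∈ blockLists N K → T (accepts N δ) → IsLahDistribution N K δ
  accepts⇒IsLahDistribution {N} {K} {δ} δ∈ ok
    with ∧-split (isLah N δ) ok
  ... | lah , sep with ∧-split (all nonempty δ) lah
  ... | ne , lah₁ with ∧-split (all (λ i → count i (concat δ) ≡ᵇ 1) (map suc (upTo N))) lah₁
  ... | counts , lah₂ with ∧-split (length (concat δ) ≡ᵇ N) lah₂
  ... | sz , dec = record
    { blockCount = proj₁ (∈-blockLists⁻ N K δ∈)
    ; letters    = All.map proj₁ (proj₂ (∈-blockLists⁻ N K δ∈))
    ; nonEmpty   = All.all⁺ nonempty δ ne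
    ; once       = λ i 1≤i i≤N → ≡ᵇ⇒≡ _ _ (All.lookup (All.all⁺ _ _ counts) (∈-letters⁺ (1≤i , i≤N)))
    ; size       = ≡ᵇ⇒≡ _ _ sz
    ; decreasing = dec
    ; separating = All.map (λ {b} → ≤ᵇ⇒≤ (separatorCount b) 1) (All.all⁺ _ δ sep)
    }

module Recurrence (q r : ℕ) where

  open FiniteSums using (Σ<)
  open QNumbers using (Σ<-q^-reversed≡qint)
  open ListSums
  open Enumeration
  open Words
  open Blocks
  open Distributions r
  open import Data.Nat using (zero; suc; _+_; _*_; _∸_; _^_; _≤_; _<_; z≤n; s≤s; _≟_)
  open import Data.Nat.Properties
  open import Data.Bool using (true; false; T; T?; if_then_else_)
  open import Data.Empty using (⊥; ⊥-elim)
  open import Data.Unit using (tt; ⊤)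
  open import Data.Sum using (_⊎_; inj₁; inj₂)
  open import Data.Product using (_×_; _,_; proj₁; proj₂; Σ)
  open import Data.List using (List; []; _∷_; map; _++_; length; filter; filterᵇ; concat; upTo; cartesianProduct)
  open import Data.List.Properties using (map-∘; length-map; filter-all; filter-none; length-filter; ∷-injectiveʳ; ∷-injectiveˡ; ≡-dec; map-upTo)
  open import Data.List.Relation.Unary.All as All using (All; []; _∷_)
  import Data.List.Relation.Unary.All.Properties as All
  open import Data.List.Relation.Unary.Any using (here; there)
  open import Data.List.Membership.Propositional using (_∈_)
  open import Data.List.Membership.Propositional.Properties
  open import Data.List.Relation.Unary.Unique.Propositional using (Unique)
  import Data.List.Relation.Unary.Unique.Propositional.Properties as Unique
  open import Data.Nat.ListAction using (sum)
  open import Relation.Binary.PropositionalEquality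
  open import Relation.Nullary using (¬_; yes; no)
  open ≡-Reasoning

  weight : List (List ℕ) → ℕ
  weight δ = q ^ invρ δ

  -- Lr q r n k unfolds to lahSum (n + r) (k + r).
  lahSum : ℕ → ℕ → ℕ
  lahSum N K = sum (map (λ δ → if accepts N δ then weight δ else 0) (blockLists N K))

  distributions : ℕ → ℕ → List (List (List ℕ))
  distributions N K = filterᵇ (accepts N) (blockLists N K)

  ∈-distributions⁻ : ∀ {N K δ} → δ ∈ distributions N K → IsLahDistribution N K δ
  ∈-distributions⁻ {N} {K} δ∈ with ∈-filter⁻ (λ δ → T? (accepts N δ)) {xs = blockLists N K} δ∈
  ... | δ∈blocks , ok = accepts⇒IsLahDistribution δ∈blocks ok

  ∈-distributions⁺ : ∀ {N K δ} → IsLahDistribution N K δ → δ ∈ distributions N K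
  ∈-distributions⁺ {N} d = ∈-filter⁺ (λ δ → T? (accepts N δ)) (IsLahDistribution⇒∈-blockLists d) (IsLahDistribution⇒accepts d)

  lahSum≡ : ∀ N K → lahSum N K ≡ sum (map weight (distributions N K))
  lahSum≡ N K = sum-map-if (accepts N) weight (blockLists N K)

  lahSum-vacuous : ∀ N K → (∀ {δ} → IsLahDistribution N K δ → ⊥) → lahSum N K ≡ 0
  lahSum-vacuous N K none = sum-map-zero-∈ (blockLists N K) term≡0
    where
    term≡0 : ∀ {δ} → δ ∈ blockLists N K → (if accepts N δ then weight δ else 0) ≡ 0
    term≡0 {δ} δ∈ with accepts N δ in e
    ... | true = ⊥-elim (none (accepts⇒IsLahDistribution δ∈ (subst T (sym e) tt)))
    ... | false = refl

  module Extension (N : ℕ) (r≤N : r ≤ N) where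

    x : ℕ
    x = suc N

    module _ {K δ} (d : IsLahDistribution N K δ) where
      open IsLahDistribution d

      letters<x : All (All (_< x)) δ
      letters<x = All.map (All.map (λ l → s≤s (proj₂ l))) letters

      fresh : All (λ b → count x b ≡ 0) δ
      fresh = All.map (λ {b} h → count-fresh x b (All.map <⇒≢ h)) letters<x

      fresh-concat : count x (concat δ) ≡ 0
      fresh-concat = count-fresh x _ (All.map <⇒≢ (All.concat⁺ letters<x))

      joined<x : All (_< x) (joined δ)
      joined<x = All-joined δ letters<x
        where
        All-joined : ∀ δ → All (All (_< x)) δ → All (_< x) (joined δ)
        All-joined [] [] = []
        All-joined (b ∷ []) (pb ∷ []) = pb
        All-joined (b ∷ c ∷ cs) (pb ∷ ps) = All.++⁺ pb (s≤s z≤n ∷ All-joined (c ∷ cs) ps)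

      singleton-isLahDistribution : IsLahDistribution x (suc K) ((x ∷ []) ∷ δ)
      singleton-isLahDistribution = record
        { blockCount = cong suc blockCount
        ; letters    = ((s≤s z≤n , ≤-refl) ∷ []) ∷ All.map (All.map (λ l → proj₁ l , m≤n⇒m≤1+n (proj₂ l))) letters
        ; nonEmpty   = _ ∷ nonEmpty
        ; once       = EachOnce-∷ N (concat δ) once fresh-concat
        ; size       = cong suc size
        ; decreasing = head-largest δ letters nonEmpty decreasing
        ; separating = length-filter (_≤? r) (x ∷ []) ∷ separating
        }
        where
        head-largest : ∀ δ → All (All (Letter N)) δ → All NonEmpty δ → T (decreasingMins δ) → T (decreasingMins ((x ∷ []) ∷ δ))
        head-largest [] _ _ _ = _
        head-largest (c ∷ cs) (lc ∷ _) (nc ∷ _) dec = ∧-join (<⇒<ᵇ (s≤s (minWord≤ N c lc nc))) dec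

    length-joined≡N+blocks : ∀ {K b bs} → IsLahDistribution N K (b ∷ bs) → length (joined (b ∷ bs)) ≡ N + length bs
    length-joined≡N+blocks {b = b} {bs} d = trans (length-joined b bs) (cong (_+ length bs) (IsLahDistribution.size d))

    invρ-singleton : ∀ {K} δ → IsLahDistribution N K δ → invρ ((x ∷ []) ∷ δ) ≡ N + K + invρ δ
    invρ-singleton [] d rewrite sym (IsLahDistribution.blockCount d) | sym (IsLahDistribution.size d) = refl
    invρ-singleton (c ∷ cs) d rewrite sym (IsLahDistribution.blockCount d) = begin
      length (filter (_<? x) (0 ∷ w)) + inv (0 ∷ w)
        ≡⟨ cong₂ _+_ (cong length (filter-all (_<? x) {xs = 0 ∷ w} (s≤s z≤n ∷ joined<x d)))
                     (cong (λ z → length z + inv w) (filter-none (_<? 0) {xs = w} (All.tabulate (λ _ ())))) ⟩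
      suc (length w) + inv w
        ≡⟨ cong (λ z → suc z + inv w) (length-joined≡N+blocks d) ⟩
      suc (N + length cs) + inv w
        ≡⟨ cong (_+ inv w) (sym (+-suc N (length cs))) ⟩
      N + suc (length cs) + inv w ∎
      where
      w = joined (c ∷ cs)

    length-joined≡N+K : ∀ {K} δ → IsLahDistribution N (suc K) δ → length (joined δ) ≡ N + K
    length-joined≡N+K [] d with () ← IsLahDistribution.blockCount d
    length-joined≡N+K (b ∷ bs) d = trans (length-joined≡N+blocks d) (cong (N +_) (suc-injective (IsLahDistribution.blockCount d)))

    position : ∀ {K p} δ → IsLahDistribution N (suc K) δ → p ≤ N + K → Position p δ
    position [] d _ with () ← IsLahDistribution.blockCount d
    position {p = p} (b ∷ bs) d p≤ = ≤length-joined⇒Position b bs p (subst (p ≤_) (sym (length-joined≡N+K (b ∷ bs) d)) p≤)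

    minWord-insertAt-max : ∀ p b → p ≤ length b → NonEmpty b × All (_< x) b → minWord (insertAt p x b) ≡ minWord b
    minWord-insertAt-max p (a ∷ w) _ (_ , a<x ∷ _) = minWord-insertAt p x a w (≤-trans (minWord≤head a w) (<⇒≤ a<x))

    separatorCount-insertAt : ∀ p b → separatorCount (insertAt p x b) ≡ separatorCount b
    separatorCount-insertAt p b = cong length (filter-insertAt (_≤? r) p x b (λ x≤r → <⇒≱ (s≤s r≤N) x≤r))

    module _ {K p δ} (d : IsLahDistribution N (suc K) δ) (p≤ : p ≤ N + K) where
      open IsLahDistribution d
      private
        pos : Position p δ
        pos = position δ d p≤

      insert-isLahDistribution : IsLahDistribution x (suc K) (insertBlocks p x δ)
      insert-isLahDistribution = record
        { blockCount = trans (length-insertBlocks x pos) blockCount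
        ; letters    = All-insertBlocks x pos (All.map (All.map (λ l → proj₁ l , m≤n⇒m≤1+n (proj₂ l))) letters)
                                              (λ p b h → All-insertAt p x b h (s≤s z≤n , ≤-refl))
        ; nonEmpty   = All-insertBlocks x pos nonEmpty (λ p b _ → insertAt-nonEmpty p x b)
        ; once       = λ i 1≤i i≤x → trans (count-insertBlocks x pos i) (EachOnce-∷ N (concat δ) once (fresh-concat d) i 1≤i i≤x)
        ; size       = trans (size-insertBlocks x pos) (cong suc size)
        ; decreasing = decreasingMins-cong (sym mins) decreasing
        ; separating = All-insertBlocks x pos separating (λ p b h → subst (_≤ 1) (sym (separatorCount-insertAt p b)) h)
        }
        where
        mins : map minWord (insertBlocks p x δ) ≡ map minWord δ
        mins = map-insertBlocks x minWord _ pos (All.zipWith (λ h → h) (nonEmpty , letters<x d)) minWord-insertAt-max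

      invρ-insert : invρ (insertBlocks p x δ) ≡ invρ δ + (N + K ∸ p)
      invρ-insert = begin
        inv (joined (insertBlocks p x δ))       ≡⟨ cong inv (joined-insertBlocks x pos) ⟩
        inv (insertAt p x (joined δ))           ≡⟨ inv-insertAt-max p x (joined δ) (joined<x d) (Position⇒≤length-joined x pos) ⟩
        invρ δ + (length (joined δ) ∸ p)        ≡⟨ cong (λ z → invρ δ + (z ∸ p)) (length-joined≡N+K δ d) ⟩
        invρ δ + (N + K ∸ p)                    ∎

    lower : ∀ {a} → Letter x a × ¬ a ≡ x → Letter N a
    lower ((1≤a , a≤x) , a≢x) = 1≤a , ≤-pred (≤∧≢⇒< a≤x a≢x)

    letters-remove : ∀ c → All (Letter x) c → All (Letter N) (remove x c)
    letters-remove c l = All.map lower (All-remove x c l)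

    once-x : ∀ {K δ} → IsLahDistribution x K δ → count x (concat δ) ≡ 1
    once-x d = IsLahDistribution.once d x (s≤s z≤n) ≤-refl

    removeSingleton-isLahDistribution : ∀ {K bs} → IsLahDistribution x (suc K) ((x ∷ []) ∷ bs) → IsLahDistribution N K bs
    removeSingleton-isLahDistribution {K} {bs} d = record
      { blockCount = suc-injective blockCount
      ; letters    = All.zipWith (λ {c} (l , f) → subst (All (Letter N)) (remove-fresh x c f) (letters-remove c l))
                                 (All.tail letters , count-concat≡0⁻ x bs x∉bs)
      ; nonEmpty   = All.tail nonEmpty
      ; once       = EachOnce-∷⁻ N (concat bs) once
      ; size       = suc-injective size
      ; decreasing = decreasingMins-tail (x ∷ []) bs decreasing
      ; separating = All.tail separating
      }
      where
      open IsLahDistribution d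
      x∉bs : count x (concat bs) ≡ 0
      x∉bs = suc-injective (trans (sym (count-∷-self x (concat bs))) (once-x d))

    module _ {K b bs} (d : IsLahDistribution x (suc K) (b ∷ bs)) (b≢[x] : ¬ b ≡ x ∷ []) where
      open IsLahDistribution d
      private
        δ = b ∷ bs
        δ′ = removeBlocks x δ
        p = positionInBlocks x δ
        pos : Position p δ′
        pos = proj₁ (insertBlocks-positionInBlocks x δ (once-x d))

      reinsert : insertBlocks p x δ′ ≡ δ
      reinsert = proj₂ (insertBlocks-positionInBlocks x δ (once-x d))

      private
        letters′ : All (All (Letter N)) δ′
        letters′ = All.map⁺ (All.map (λ {c} → letters-remove c) letters)

        nonEmpty′ : All NonEmpty δ′
        nonEmpty′ = All.map⁺ (All.tabulate remove-nonEmpty-block)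
          where
          at-most-once : ∀ {c} → c ∈ δ → count x c ≤ 1
          at-most-once c∈ = ≤-trans (All.lookup (count≤count-concat x δ) c∈) (≤-reflexive (once-x d))
          minWord-b≤x : minWord b ≤ x
          minWord-b≤x = minWord≤ x b (All.lookup letters (here refl)) (All.lookup nonEmpty (here refl))
          tail-not-[x] : ∀ {c} → c ∈ bs → ¬ c ≡ x ∷ []
          tail-not-[x] c∈ refl = <-irrefl refl (<-≤-trans (All.lookup (decreasingMins-head b bs decreasing) c∈) minWord-b≤x)
          remove-nonEmpty-block : ∀ {c} → c ∈ δ → NonEmpty (remove x c)
          remove-nonEmpty-block c∈@(here refl) = remove-nonEmpty x b (at-most-once c∈) b≢[x] (All.lookup nonEmpty c∈)
          remove-nonEmpty-block c∈@(there c∈bs) = remove-nonEmpty x _ (at-most-once c∈) (tail-not-[x] c∈bs) (All.lookup nonEmpty c∈)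

        counts : ∀ i → count i (concat δ) ≡ count i (x ∷ concat δ′)
        counts i = subst (λ z → count i (concat z) ≡ count i (x ∷ concat δ′)) reinsert (count-insertBlocks x pos i)

        mins : map minWord (insertBlocks p x δ′) ≡ map minWord δ′
        mins = map-insertBlocks x minWord _ pos
                 (All.zipWith (λ h → h) (nonEmpty′ , All.map (All.map (λ l → s≤s (proj₂ l))) letters′)) minWord-insertAt-max

        separators : map separatorCount (insertBlocks p x δ′) ≡ map separatorCount δ′
        separators = map-insertBlocks x separatorCount (λ _ → ⊤) pos (All.tabulate (λ _ → tt)) (λ p b _ _ → separatorCount-insertAt p b)

      removeInserted-isLahDistribution : IsLahDistribution N (suc K) δ′
      removeInserted-isLahDistribution = record
        { blockCount = trans (length-map (remove x) δ) blockCount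
        ; letters    = letters′
        ; nonEmpty   = nonEmpty′
        ; once       = EachOnce-∷⁻ N (concat δ′) (λ i 1≤i i≤x → trans (sym (counts i)) (once i 1≤i i≤x))
        ; size       = suc-injective (trans (sym (subst (λ z → length (concat z) ≡ suc (length (concat δ′))) reinsert
                                                         (size-insertBlocks x pos)))
                                            size)
        ; decreasing = decreasingMins-cong mins (subst (λ z → T (decreasingMins z)) (sym reinsert) decreasing)
        ; separating = All.map⁻ (subst (All (_≤ 1)) separators
                                       (All.map⁺ (subst (All (λ c → separatorCount c ≤ 1)) (sym reinsert) separating)))
        }

      removeInserted-position : p ≤ N + K
      removeInserted-position = subst (p ≤_) (length-joined≡N+K δ′ removeInserted-isLahDistribution) (Position⇒≤length-joined x pos)

    Source : Set
    Source = List (List ℕ) ⊎ (List (List ℕ) × ℕ)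

    extend : Source → List (List ℕ)
    extend (inj₁ δ) = (x ∷ []) ∷ δ
    extend (inj₂ (δ , p)) = insertBlocks p x δ

    sources : ℕ → List Source
    sources K = map inj₁ (distributions N K) ++ map inj₂ (cartesianProduct (distributions N (suc K)) (upTo (suc (N + K))))

    data SourceView (K : ℕ) : Source → Set where
      singleton : ∀ {δ} → IsLahDistribution N K δ → SourceView K (inj₁ δ)
      inserted  : ∀ {δ p} → IsLahDistribution N (suc K) δ → p ≤ N + K → SourceView K (inj₂ (δ , p))

    view : ∀ {K y} → y ∈ sources K → SourceView K y
    view {K} y∈ with ∈-++⁻ (map inj₁ (distributions N K)) y∈
    ... | inj₁ y∈₁ with ∈-map⁻ inj₁ y∈₁
    ...   | δ , δ∈ , refl = singleton (∈-distributions⁻ δ∈)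
    view {K} y∈ | inj₂ y∈₂ with ∈-map⁻ inj₂ y∈₂
    ...   | (δ , p) , δp∈ , refl with ∈-cartesianProduct⁻ (distributions N (suc K)) (upTo (suc (N + K))) δp∈
    ...     | δ∈ , p∈ = inserted (∈-distributions⁻ δ∈) (≤-pred (∈-upTo⁻ p∈))

    sources-unique : ∀ K → Unique (sources K)
    sources-unique K = Unique.++⁺ (Unique.map⁺ inj₁-injective (distributions-unique K))
      (Unique.map⁺ inj₂-injective (Unique.cartesianProduct⁺ (distributions-unique (suc K)) (Unique.upTo⁺ (suc (N + K)))))
      (λ (m₁ , m₂) → inj₁≢inj₂ (∈-map⁻ inj₁ m₁) (∈-map⁻ inj₂ m₂))
      where
      open import Data.Sum.Properties using (inj₁-injective; inj₂-injective)
      distributions-unique : ∀ K → Unique (distributions N K)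
      distributions-unique K = Unique.filter⁺ (λ δ → T? (accepts N δ)) (blockLists-unique N K)
      inj₁≢inj₂ : ∀ {v : Source} → Σ _ (λ δ → _ × v ≡ inj₁ δ) → Σ _ (λ δp → _ × v ≡ inj₂ δp) → ⊥
      inj₁≢inj₂ (_ , _ , refl) (_ , _ , ())

    singleton≢insert : ∀ {p δ δ₁} → Position p δ → All NonEmpty δ → All (λ b → count x b ≡ 0) δ →
      ¬ ((x ∷ []) ∷ δ₁ ≡ insertBlocks p x δ)
    singleton≢insert {_} {b ∷ bs} (inHead {p} le) (nb ∷ _) _ e
      with b | nb | trans (sym (length-insertAt p x b)) (cong length (sym (∷-injectiveˡ (trans e (insertBlocks-head p x b bs le)))))
    ... | a ∷ w | _ | ()
    singleton≢insert {_} {b ∷ bs} (inTail {p} pos) _ (fresh-b ∷ _) e with ∷-injectiveˡ (trans e (insertBlocks-tail p x b bs))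
    ... | refl with () ← trans (sym (count-∷-self x [])) fresh-b

    extend-injective : ∀ {K y y′} → y ∈ sources K → y′ ∈ sources K → extend y ≡ extend y′ → y ≡ y′
    extend-injective {K} y∈ y′∈ e with view {K} y∈ | view {K} y′∈
    ... | singleton _ | singleton _ = cong inj₁ (∷-injectiveʳ e)
    ... | singleton _ | inserted d′ le′ = ⊥-elim (singleton≢insert (position _ d′ le′) (IsLahDistribution.nonEmpty d′) (fresh d′) e)
    ... | inserted d le | singleton _ = ⊥-elim (singleton≢insert (position _ d le) (IsLahDistribution.nonEmpty d) (fresh d) (sym e))
    ... | inserted {δ} {p} d le | inserted {δ′} {p′} d′ le′ = cong inj₂ (cong₂ _,_ δ≡δ′ p≡p′)
      where
      pos : Position p δ
      pos = position δ d le
      pos′ : Position p′ δ′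
      pos′ = position δ′ d′ le′
      δ≡δ′ : δ ≡ δ′
      δ≡δ′ = trans (sym (removeBlocks-insertBlocks x pos (fresh d)))
                   (trans (cong (removeBlocks x) e) (removeBlocks-insertBlocks x pos′ (fresh d′)))
      p≡p′ : p ≡ p′
      p≡p′ = trans (sym (positionInBlocks-insertBlocks x pos (fresh d)))
                   (trans (cong (positionInBlocks x) e) (positionInBlocks-insertBlocks x pos′ (fresh d′)))

    accepted : ∀ {K δ} → IsLahDistribution x K δ → δ ∈ blockLists x K × T (accepts x δ)
    accepted d = IsLahDistribution⇒∈-blockLists d , IsLahDistribution⇒accepts d

    extend-into : ∀ {K y} → y ∈ sources K → extend y ∈ blockLists x (suc K) × T (accepts x (extend y))
    extend-into {K} y∈ with view {K} y∈
    ... | singleton d = accepted (singleton-isLahDistribution d)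
    ... | inserted d le = accepted (insert-isLahDistribution d le)

    extend-onto : ∀ {K δ} → δ ∈ blockLists x (suc K) → T (accepts x δ) → Σ Source (λ y → y ∈ sources K × extend y ≡ δ)
    extend-onto {K} δ∈ ok = onto (accepts⇒IsLahDistribution δ∈ ok)
      where
      onto : ∀ {δ} → IsLahDistribution x (suc K) δ → Σ Source (λ y → y ∈ sources K × extend y ≡ δ)
      onto {[]} d with () ← IsLahDistribution.blockCount d
      onto {b ∷ bs} d with ≡-dec _≟_ b (x ∷ [])
      ... | yes refl = inj₁ bs , ∈-++⁺ˡ (∈-map⁺ inj₁ (∈-distributions⁺ (removeSingleton-isLahDistribution d))) , refl
      ... | no b≢[x] = inj₂ (removeBlocks x (b ∷ bs) , positionInBlocks x (b ∷ bs))
                     , ∈-++⁺ʳ (map inj₁ (distributions N K)) (∈-map⁺ inj₂ (∈-cartesianProduct⁺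
                         (∈-distributions⁺ (removeInserted-isLahDistribution d b≢[x])) (∈-upTo⁺ (s≤s (removeInserted-position d b≢[x])))))
                     , reinsert d b≢[x]

    sum-weight-singletons : ∀ K → sum (map (λ δ → weight ((x ∷ []) ∷ δ)) (distributions N K)) ≡ q ^ (N + K) * lahSum N K
    sum-weight-singletons K = begin
      sum (map (λ δ → weight ((x ∷ []) ∷ δ)) (distributions N K))
        ≡⟨ sum-map-cong-∈ (distributions N K) (λ {δ} δ∈ → trans (cong (q ^_) (invρ-singleton δ (∈-distributions⁻ δ∈)))
                                                             (^-distribˡ-+-* q (N + K) (invρ δ))) ⟩
      sum (map (λ δ → q ^ (N + K) * weight δ) (distributions N K))
        ≡⟨ sum-map-*ˡ (q ^ (N + K)) weight (distributions N K) ⟩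
      q ^ (N + K) * sum (map weight (distributions N K))
        ≡⟨ cong (q ^ (N + K) *_) (sym (lahSum≡ N K)) ⟩
      q ^ (N + K) * lahSum N K ∎

    sum-weight-positions : ∀ {K δ} → δ ∈ distributions N (suc K) →
      sum (map (λ p → weight (insertBlocks p x δ)) (upTo (suc (N + K)))) ≡ qint q (suc (N + K)) * weight δ
    sum-weight-positions {K} {δ} δ∈ = begin
      sum (map (λ p → weight (insertBlocks p x δ)) (upTo (suc (N + K))))
        ≡⟨ sum-map-cong-∈ (upTo (suc (N + K))) (λ {p} p∈ →
             trans (cong (q ^_) (invρ-insert (∈-distributions⁻ δ∈) (≤-pred (∈-upTo⁻ p∈)))) (^-distribˡ-+-* q (invρ δ) _)) ⟩
      sum (map (λ p → weight δ * q ^ (N + K ∸ p)) (upTo (suc (N + K))))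
        ≡⟨ sum-map-*ˡ (weight δ) (λ p → q ^ (N + K ∸ p)) (upTo (suc (N + K))) ⟩
      weight δ * sum (map (λ p → q ^ (N + K ∸ p)) (upTo (suc (N + K))))
        ≡⟨ cong (λ z → weight δ * sum z) (map-upTo (λ p → q ^ (N + K ∸ p)) (suc (N + K))) ⟩
      weight δ * Σ< (suc (N + K)) (λ p → q ^ (suc (N + K) ∸ suc p))
        ≡⟨ cong (weight δ *_) (Σ<-q^-reversed≡qint q (suc (N + K))) ⟩
      weight δ * qint q (suc (N + K))
        ≡⟨ *-comm (weight δ) _ ⟩
      qint q (suc (N + K)) * weight δ ∎

    sum-weight-insertions : ∀ K →
      sum (map (λ (δ , p) → weight (insertBlocks p x δ)) (cartesianProduct (distributions N (suc K)) (upTo (suc (N + K)))))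
        ≡ qint q (suc (N + K)) * lahSum N (suc K)
    sum-weight-insertions K = begin
      sum (map (λ (δ , p) → weight (insertBlocks p x δ)) (cartesianProduct (distributions N (suc K)) (upTo (suc (N + K)))))
        ≡⟨ sum-map-cartesianProduct (λ (δ , p) → weight (insertBlocks p x δ)) (distributions N (suc K)) (upTo (suc (N + K))) ⟩
      sum (map (λ δ → sum (map (λ p → weight (insertBlocks p x δ)) (upTo (suc (N + K))))) (distributions N (suc K)))
        ≡⟨ sum-map-cong-∈ (distributions N (suc K)) sum-weight-positions ⟩
      sum (map (λ δ → qint q (suc (N + K)) * weight δ) (distributions N (suc K)))
        ≡⟨ sum-map-*ˡ (qint q (suc (N + K))) weight (distributions N (suc K)) ⟩
      qint q (suc (N + K)) * sum (map weight (distributions N (suc K)))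
        ≡⟨ cong (qint q (suc (N + K)) *_) (sym (lahSum≡ N (suc K))) ⟩
      qint q (suc (N + K)) * lahSum N (suc K) ∎

    lahSum-step : ∀ K → lahSum x (suc K) ≡ q ^ (N + K) * lahSum N K + qint q (suc (N + K)) * lahSum N (suc K)
    lahSum-step K = begin
      lahSum x (suc K)
        ≡⟨ sum-filter-bijection {xs = blockLists x (suc K)} {ys = sources K} (accepts x) weight extend
                                (blockLists-unique x (suc K)) (sources-unique K)
                                (extend-injective {K}) (extend-into {K}) (extend-onto {K}) ⟩
      sum (map (λ y → weight (extend y)) (sources K))
        ≡⟨ sum-map-++ (λ y → weight (extend y)) (map inj₁ (distributions N K)) _ ⟩
      sum (map (λ y → weight (extend y)) (map inj₁ (distributions N K))) + sum (map (λ y → weight (extend y)) (map inj₂ pairs))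
        ≡⟨ cong₂ _+_ (trans (cong sum (sym (map-∘ (distributions N K)))) (sum-weight-singletons K))
                     (trans (cong sum (sym (map-∘ pairs))) (sum-weight-insertions K)) ⟩
      q ^ (N + K) * lahSum N K + qint q (suc (N + K)) * lahSum N (suc K) ∎
      where
      pairs = cartesianProduct (distributions N (suc K)) (upTo (suc (N + K)))

  N<K⇒lahSum≡0 : ∀ {N K} → N < K → lahSum N K ≡ 0
  N<K⇒lahSum≡0 {N} {K} N<K = lahSum-vacuous N K λ {δ} d →
    let open IsLahDistribution d in
    <⇒≱ N<K (subst (_≤ N) blockCount (≤-trans (blocks≤size δ nonEmpty) (≤-reflexive size)))

  K<r⇒lahSum-r≡0 : ∀ {K} → K < r → lahSum r K ≡ 0
  K<r⇒lahSum-r≡0 {K} K<r = lahSum-vacuous r K λ {δ} d →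
    let open IsLahDistribution d in
    <⇒≱ K<r (subst (_≤ K) size (subst (length (concat δ) ≤_) blockCount (size≤blocks δ (singletons δ letters separating))))
    where
    singletons : ∀ δ → All (All (Letter r)) δ → All (λ b → separatorCount b ≤ 1) δ → All (λ b → length b ≤ 1) δ
    singletons [] [] [] = []
    singletons (b ∷ δ) (lb ∷ ls) (sb ∷ ss) =
      subst (_≤ 1) (cong length (filter-all (_≤? r) {xs = b} (All.map proj₂ lb))) sb ∷ singletons δ ls ss

  K<r⇒lahSum≡0 : ∀ d {K} → K < r → lahSum (d + r) K ≡ 0
  K<r⇒lahSum≡0 zero K<r = K<r⇒lahSum-r≡0 K<r
  K<r⇒lahSum≡0 (suc d) {zero} K<r = refl  -- isLah computes to false on the empty list of blocks
  K<r⇒lahSum≡0 (suc d) {suc K} K<r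
    rewrite Extension.lahSum-step (d + r) (m≤n+m r d) K
          | K<r⇒lahSum≡0 d (<-trans (n<1+n K) K<r) | K<r⇒lahSum≡0 d {suc K} K<r =
    cong₂ _+_ (*-zeroʳ (q ^ (d + r + K))) (*-zeroʳ (qint q (suc (d + r + K))))

module LahNumbers where

  open import Data.Nat using (zero; suc; _+_; _*_; _^_)
  open import Data.Nat.Properties using (*-zeroʳ; m≤n+m; n<1+n; +-monoˡ-<)
  open import Data.Nat.Solver using (module +-*-Solver)
  open import Relation.Binary.PropositionalEquality
  open +-*-Solver using (solve; _:=_; _:+_; _:*_; con)
  open ≡-Reasoning

  Lr-step-zero : ∀ q r n → Lr q r (suc n) 0 ≡ qint q (2 * r + n) * Lr q r n 0
  Lr-step-zero q zero zero = refl
  Lr-step-zero q zero (suc n) = sym (*-zeroʳ (qint q (suc n)))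
  Lr-step-zero q (suc r) n = begin
    lahSum (suc N) (suc r)
      ≡⟨ Extension.lahSum-step N (m≤n+m (suc r) n) r ⟩
    q ^ (N + r) * lahSum N r + qint q (suc (N + r)) * Lr q (suc r) n 0
      ≡⟨ cong₂ (λ a e → q ^ (N + r) * a + qint q e * Lr q (suc r) n 0)
               (K<r⇒lahSum≡0 n (n<1+n r))
               (solve 2 (λ n r → con 1 :+ (n :+ (con 1 :+ r) :+ r) := con 2 :* (con 1 :+ r) :+ n) refl n r) ⟩
    q ^ (N + r) * 0 + qint q (2 * suc r + n) * Lr q (suc r) n 0
      ≡⟨ cong (_+ qint q (2 * suc r + n) * Lr q (suc r) n 0) (*-zeroʳ (q ^ (N + r))) ⟩
    qint q (2 * suc r + n) * Lr q (suc r) n 0 ∎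
    where
    open Recurrence q (suc r)
    N = n + suc r

  Lr-isLahArray : ∀ q r → LahArrays.IsLahArray q (2 * r) (Lr q r)
  Lr-isLahArray q r = record { step-zero = Lr-step-zero q r ; step-suc = step-suc }
    where
    open Recurrence q r
    step-suc : ∀ n k →
      Lr q r (suc n) (suc k) ≡ q ^ (2 * r + n + k) * Lr q r n k + qint q (suc (2 * r + n + k)) * Lr q r n (suc k)
    step-suc n k = trans (Extension.lahSum-step (n + r) (m≤n+m r n) (k + r))
      (cong (λ e → q ^ e * Lr q r n k + qint q (suc e) * Lr q r n (suc k))
            (solve 3 (λ n r k → n :+ r :+ (k :+ r) := con 2 :* r :+ n :+ k) refl n r k))

  Lr-lowerTriangular : ∀ q r → LahArrays.LowerTriangular q (Lr q r)
  Lr-lowerTriangular q r n<k = Recurrence.N<K⇒lahSum≡0 q r (+-monoˡ-< r n<k)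

module Expansion (q r m : ℕ) where

  open FiniteSums
  open LahArrays q
  open LahNumbers
  open import Data.Nat using (suc; _+_; _*_; _∸_)
  open import Data.Nat.Properties using (+-assoc; +-identityʳ)
  open import Relation.Binary.PropositionalEquality
  open ≡-Reasoning

  shift : ℕ → ℕ
  shift j = j + m + 2 * r

  summand : ℕ → ℕ → ℕ → ℕ
  summand j = lahTransform (shift j) (L q)

  Lr-rows≡convolution : ∀ n k → Lr q r (m + n) k ≡ convolution (Lr q r m) summand n k
  Lr-rows≡convolution =
    lahArray-unique (lahArray-dropRows m (Lr-isLahArray q r)) (convolution-isLahArray (Lr q r m) summand-isLahArray) row-zero
    where
    summand-isLahArray : ∀ j → IsLahArray (j + (m + 2 * r)) (summand j)
    summand-isLahArray j =
      subst (λ c → IsLahArray c (summand j)) (+-assoc j m (2 * r)) (lahTransform-isLahArray (Lr-isLahArray q 0) (shift j))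
    row-zero : ∀ k → Lr q r (m + 0) k ≡ convolution (Lr q r m) summand 0 k
    row-zero k = trans (cong (λ z → Lr q r z k) (+-identityʳ m))
      (sym (convolution-row-zero (Lr q r m) summand (λ j → lahTransform-row-zero (shift j) (L q) 0)
              (λ j {l} 0<l → trans (lahTransform-row-zero (shift j) (L q) l) (Lr-lowerTriangular q 0 0<l)) k))

  Lr-expansion : ∀ n k →
    Lr q r (m + n) k ≡ Σ≤ n (λ i → Σ≤ k (λ j → lahCoeff (shift j) n i * Lr q r m j * L q i (k ∸ j)))
  Lr-expansion n k = begin
    Lr q r (m + n) k ≡⟨ Lr-rows≡convolution n k ⟩
    Σ< (suc k) (λ j → Lr q r m j * Σ< (suc n) (λ i → lahCoeff (shift j) n i * L q i (k ∸ j)))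
      ≡⟨ Σ<-*-Σ<-comm (suc k) (suc n) (Lr q r m) (λ j i → lahCoeff (shift j) n i) (λ j i → L q i (k ∸ j)) ⟩
    Σ< (suc n) (λ i → Σ< (suc k) (λ j → lahCoeff (shift j) n i * Lr q r m j * L q i (k ∸ j)))
      ≡⟨ sym (Σ≤-Σ≤≡Σ<-Σ< n k _) ⟩
    Σ≤ n (λ i → Σ≤ k (λ j → lahCoeff (shift j) n i * Lr q r m j * L q i (k ∸ j))) ∎

  Lrtot-expansion : ∀ n →
    Lrtot q r (m + n) ≡ Σ≤ n (λ i → Σ≤ m (λ j → lahCoeff (shift j) n i * Lr q r m j * Ltot q i))
  Lrtot-expansion n = begin
    Σ≤ (m + n) (Lr q r (m + n))
      ≡⟨ Σ≤≡Σ< (m + n) (Lr q r (m + n)) ⟩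
    Σ< (suc (m + n)) (Lr q r (m + n))
      ≡⟨ Σ<-cong (suc (m + n)) (λ k _ → Lr-rows≡convolution n k) ⟩
    Σ< (suc (m + n)) (convolution (Lr q r m) summand n)
      ≡⟨ Σ<-convolution (Lr q r m) summand (Lr-lowerTriangular q r)
                        (λ j → lahTransform-lowerTriangular (shift j) (Lr-lowerTriangular q 0)) ⟩
    Σ< (suc m) (λ j → Lr q r m j * Σ< (suc n) (summand j n))
      ≡⟨ Σ<-cong (suc m) (λ j _ → cong (Lr q r m j *_) (Σ<-lahTransform (shift j) n (Lr-lowerTriangular q 0))) ⟩
    Σ< (suc m) (λ j → Lr q r m j * Σ< (suc n) (λ i → lahCoeff (shift j) n i * Σ< (suc i) (L q i)))
      ≡⟨ Σ<-*-Σ<-comm (suc m) (suc n) (Lr q r m) (λ j i → lahCoeff (shift j) n i) (λ j i → Σ< (suc i) (L q i)) ⟩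
    Σ< (suc n) (λ i → Σ< (suc m) (λ j → lahCoeff (shift j) n i * Lr q r m j * Σ< (suc i) (L q i)))
      ≡⟨ sym (trans (Σ≤-Σ≤≡Σ<-Σ< n m _) (Σ<-cong (suc n) (λ i _ → Σ<-cong (suc m) (λ j _ →
               cong (lahCoeff (shift j) n i * Lr q r m j *_) (Σ≤≡Σ< i (L q i)))))) ⟩
    Σ≤ n (λ i → Σ≤ m (λ j → lahCoeff (shift j) n i * Lr q r m j * Ltot q i)) ∎

theorem2p4 : (q m n r k : ℕ) →
    (Lr q r (m + n) k ≡
      Σ≤ n (λ i → Σ≤ k (λ j →
        q ^ (i * (j + m + 2 * r)) * qrising q (j + m + 2 * r) (n ∸ i) * qbinom q n i
          * Lr q r m j * L q i (k ∸ j))))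
    ×
    (Lrtot q r (m + n) ≡
      Σ≤ n (λ i → Σ≤ m (λ j →
        q ^ (i * (j + m + 2 * r)) * qrising q (j + m + 2 * r) (n ∸ i) * qbinom q n i
          * Lr q r m j * Ltot q i)))
theorem2p4 q m n r k = Expansion.Lr-expansion q r m n k , Expansion.Lrtot-expansion q r m n
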